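{- Let $n\geq 2$ and $m\geq 1$ be integers, and let $K_n^{(m)}$ be the windmill graph. Then \[ T_{K_n^{(m)}}(z)=\begin{cases} 2^{m(n-2)+1}z^{m(n-2)}\left[(2^m-1)z^2+1\right] & \text{if } n \text{ is even},\\ 2^{m(n-2)+1}z^{m(n-3)+2}\left[(z^2+1)^m-z^{2m}+z^{2m-2}\right] & \text{if } n \text{ is odd}. \end{cases} \]
   Context: The windmill graph $K_n^{(m)}$ is obtained from the disjoint union of $m$ copies of the complete graph $K_n$ (no loops) by identifying one vertex from each copy into a single common vertex. For a simple graph $G$ with adjacency matrix $M$ over $\mathbb{F}_2$ and $S\subseteq V(G)$, $M[S]$ is the principal submatrix indexed by $S$ ($M[\emptyset]$ nonsingular by convention); $D(G)=(V(G),\{S:M[S]\text{ nonsingular}\})$. For a set system $D=(E,\mathcal{F})$: $D*A=(E,\{X\triangle A:X\in\mathcal{F}\})$, $w(D)=\max_{F\in\mathcal{F}}|F|-\min_{F\in\mathcal{F}}|F|$, $T_D(z)=\sum_{A\subseteq E}z^{w(D*A)}$, $T_G=T_{D(G)}$. -}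

module Defs where

open import Data.Bool using (Bool; true; false; _∧_; _xor_; not; if_then_else_)
open import Data.Nat as ℕ using (ℕ; zero; suc; _∸_; _⊔_; _⊓_)
open import Data.Fin using (Fin; zero; suc; punchIn; remQuot; _≟_)
open import Data.Fin.Subset using (Subset; ∣_∣)
open import Data.Vec using (Vec; []; _∷_; zipWith; lookup)
open import Data.List using (List; []; _∷_; _++_; map; foldr; length; filter)
open import Data.Integer as ℤ using (ℤ)
open import Data.Product using (_,_; proj₁; proj₂)
open import Relation.Nullary.Decidable using (does)
open import Data.Bool.Properties using (T?)

-- Simple graphs on the vertex set Fin N, given by their adjacency matrix
-- over 𝔽₂ = Bool (true = 1, false = 0; addition = xor, product = ∧).

Matrix₂ : ℕ → Set
Matrix₂ k = Fin k → Fin k → Bool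


-- Determinant over 𝔽₂ by cofactor (Laplace) expansion along the first row;
-- signs disappear in characteristic 2.
xorSum : ∀ {k} → (Fin k → Bool) → Bool
xorSum {zero}  f = false
xorSum {suc k} f = f zero xor xorSum (λ j → f (suc j))

det₂ : ∀ k → Matrix₂ k → Bool
det₂ zero    M = true
det₂ (suc k) M = xorSum (λ j → M zero j ∧ det₂ k (λ r c → M (suc r) (punchIn j c)))

nonsingular : ∀ {k} → Matrix₂ k → Bool
nonsingular {k} M = det₂ k M

elems : ∀ {N} → Subset N → List (Fin N)
elems {zero}  []          = []
elems {suc N} (true  ∷ S) = zero ∷ map suc (elems S)
elems {suc N} (false ∷ S) = map suc (elems S)

lookupL : ∀ {A : Set} (xs : List A) → Fin (length xs) → A
lookupL (x ∷ xs) zero    = x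
lookupL (x ∷ xs) (suc i) = lookupL xs i

principal : ∀ {N} (M : Fin N → Fin N → Bool) (S : Subset N) →
            Matrix₂ (length (elems S))
principal M S i j = M (lookupL (elems S) i) (lookupL (elems S) j)

SetSystem : ℕ → Set
SetSystem N = Subset N → Bool

D : ∀ {N} → (Fin N → Fin N → Bool) → SetSystem N
D M S = nonsingular (principal M S)

_△_ : ∀ {N} → Subset N → Subset N → Subset N
X △ A = zipWith _xor_ X A

-- Twist D * A = (E, {X △ A : X ∈ 𝓕}).  (X ∈ 𝓕*A iff X △ A ∈ 𝓕.)
_✱_ : ∀ {N} → SetSystem N → Subset N → SetSystem N
(𝓕 ✱ A) X = 𝓕 (X △ A)

allSubsets : ∀ N → List (Subset N)
allSubsets zero    = [] ∷ []
allSubsets (suc N) = map (true ∷_) (allSubsets N) ++ map (false ∷_) (allSubsets N)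

feasibleSets : ∀ {N} → SetSystem N → List (Subset N)
feasibleSets {N} 𝓕 = filter (λ X → T? (𝓕 X)) (allSubsets N)

-- width w(D) = max |F| - min |F| over feasible F
-- (min taken starting from N, which is an upper bound of all sizes;
--  all set systems considered here are nonempty).
maxSize minSize : ∀ {N} → SetSystem N → ℕ
maxSize 𝓕 = foldr (λ X r → ∣ X ∣ ⊔ r) 0 (feasibleSets 𝓕)
minSize {N} 𝓕 = foldr (λ X r → ∣ X ∣ ⊓ r) N (feasibleSets 𝓕)

width : ∀ {N} → SetSystem N → ℕ
width 𝓕 = maxSize 𝓕 ∸ minSize 𝓕

Tpoly : ∀ {N} → SetSystem N → ℤ → ℤ
Tpoly {N} 𝓕 z = foldr (λ A r → (z ℤ.^ width (𝓕 ✱ A)) ℤ.+ r) (ℤ.+ 0) (allSubsets N)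

T-graph : ∀ {N} → (Fin N → Fin N → Bool) → ℤ → ℤ
T-graph M = Tpoly (D M)

-- Windmill graph K_n^(m): vertex 0 is the common vertex; the remaining
-- m*(n-1) vertices are split (via remQuot) into m blades of n-1 vertices.

windmillSize : ℕ → ℕ → ℕ
windmillSize n m = suc (m ℕ.* (n ∸ 1))

windmill : ∀ n m → Fin (windmillSize n m) → Fin (windmillSize n m) → Bool
windmill n m zero    zero    = false
windmill n m zero    (suc _) = true
windmill n m (suc _) zero    = true
windmill n m (suc a) (suc b) with remQuot {m} (n ∸ 1) a | remQuot {m} (n ∸ 1) b
... | (ba , pa) | (bb , pb) = does (ba ≟ bb) ∧ not (does (pa ≟ pb))

module Submission where

-- Put the centre first and split the other vertices into m blades of K = n - 1
-- vertices.  A minor of the adjacency matrix over 𝔽₂ with row set R and column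
-- set C is a coefficient of a product, in 𝔽₂[εᵣ, ε꜀]/(εᵣ², ε꜀²), of one factor
-- per blade: the centre row and column consist of ones and are used by at most
-- one blade, and the factor of a blade depends only on |R ∩ C| mod 2 and on
-- whether R ∖ C and C ∖ R are empty or single vertices.  This follows because
-- the coefficient satisfies the Laplace expansion along every row.  On the
-- diagonal it says that S is feasible iff either S avoids the centre and meets
-- every blade evenly, or S contains the centre and meets exactly one blade oddly.
--
-- The feasible sets of D(G) * A are the F △ A with F feasible.  Optimising
-- |F △ A| blade by blade, the width of D(G) * A depends only on whether A
-- contains the centre and on which blades A meets oddly, each such pattern
-- arising from 2^{m(K-1)} sets A.  Summing z^width over the patterns with the
-- binomial theorem gives the formula; the parity of n enters as that of K.

open import Data.Bool using (Bool; true; false; _∧_; _∨_; _xor_; not; if_then_else_; T)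
open import Data.Bool.Properties as BoolP using (∧-zeroʳ; ∧-identityʳ)
open import Data.Fin using (Fin; zero; suc; _↑ˡ_; _↑ʳ_; punchIn)
import Data.Fin.Properties as FinP
open import Data.Fin.Subset using (Subset)
open import Data.List using (List; []; _∷_; map)
open import Data.Maybe using (Maybe; just; nothing)
import Data.Maybe.Properties as MaybeP
open import Data.Nat as ℕ using (ℕ; zero; suc; _≤_; _<_; z≤n; s≤s)
open import Data.Product using (_×_; _,_; proj₁; proj₂)
import Data.Product.Properties as ProductP
open import Data.Sum using (inj₁; inj₂)
open import Data.Vec using ([]; _∷_)
import Data.Vec as Vec
open import Data.Vec.Functional using (Vector; head; tail; take; drop; foldr)
open import Function using (_∘_)
open import Function.Bundles using (Equivalence)
open import Function.Definitions using (Injective)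
open import Relation.Binary.Definitions using (DecidableEquality)
open import Relation.Binary.PropositionalEquality
open import Relation.Nullary using (contradiction)
open import Relation.Nullary.Decidable using (does; yes; isYes; toWitness; dec-true; dec-false; map′)

open import Defs using (xorSum; det₂; windmill; elems; lookupL; D)

-- Identities between functions on finite types, checked by evaluation

record Exhaustible (A : Set) : Set where
  field
    every       : (A → Bool) → Bool
    every-sound : ∀ p → T (every p) → ∀ x → T (p x)
    decEq       : DecidableEquality A

open Exhaustible ⦃ … ⦄

private
  T-∧ : ∀ {a b} → T (a ∧ b) → T a × T b
  T-∧ = Equivalence.to BoolP.T-∧

instance
  Bool-exhaustible : Exhaustible Bool
  Bool-exhaustible = record
    { every       = λ p → p false ∧ p true
    ; every-sound = λ { p t false → proj₁ (T-∧ t) ; p t true → proj₂ (T-∧ {p false} t) }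
    ; decEq       = BoolP._≟_ }

  ×-exhaustible : ∀ {A B} → ⦃ Exhaustible A ⦄ → ⦃ Exhaustible B ⦄ → Exhaustible (A × B)
  ×-exhaustible = record
    { every       = λ p → every λ a → every λ b → p (a , b)
    ; every-sound = λ p t (a , b) → every-sound _ (every-sound _ t a) b
    ; decEq       = ProductP.≡-dec decEq decEq }

  Maybe-exhaustible : ∀ {A} → ⦃ Exhaustible A ⦄ → Exhaustible (Maybe A)
  Maybe-exhaustible = record
    { every       = λ p → p nothing ∧ every (λ a → p (just a))
    ; every-sound = λ { p t nothing  → proj₁ (T-∧ t)
                      ; p t (just a) → every-sound _ (proj₂ (T-∧ {p nothing} t)) a }
    ; decEq       = MaybeP.≡-dec decEq }

retract : ∀ {A B : Set} ⦃ _ : Exhaustible B ⦄ (to : A → B) (from : B → A) →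
          (∀ x → from (to x) ≡ x) → Exhaustible A
retract to from from∘to = record
  { every       = λ p → every (p ∘ from)
  ; every-sound = λ p t x → subst (T ∘ p) (from∘to x) (every-sound _ t (to x))
  ; decEq       = λ x y → map′ (λ e → trans (sym (from∘to x)) (trans (cong from e) (from∘to y)))
                                (cong to) (decEq (to x) (to y)) }

by-evaluation : ∀ {A B : Set} ⦃ _ : Exhaustible A ⦄ ⦃ _ : Exhaustible B ⦄ (f g : A → B) →
                {T (every λ x → isYes (decEq (f x) (g x)))} → f ≗ g
by-evaluation f g {t} x = toWitness {a? = decEq (f x) (g x)} (every-sound _ t x)

-- The algebra 𝔽₂[εᵣ, ε꜀]/(εᵣ², ε꜀²) and blade monomials

-- ⟨ a , b , c , d ⟩ stands for a + b εᵣ + c ε꜀ + d εᵣε꜀.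
data 𝔸 : Set where
  ⟨_,_,_,_⟩ : Bool → Bool → Bool → Bool → 𝔸

infixl 6 _⊕_
infixl 7 _⊛_ _⊗_
infixr 8 _·_

_⊕_ : 𝔸 → 𝔸 → 𝔸
⟨ a , b , c , d ⟩ ⊕ ⟨ a′ , b′ , c′ , d′ ⟩ = ⟨ a xor a′ , b xor b′ , c xor c′ , d xor d′ ⟩

_⊛_ : 𝔸 → 𝔸 → 𝔸
⟨ a , b , c , d ⟩ ⊛ ⟨ a′ , b′ , c′ , d′ ⟩ =
  ⟨ a ∧ a′ , (a ∧ b′) xor (b ∧ a′) , (a ∧ c′) xor (c ∧ a′) ,
    (a ∧ d′) xor (d ∧ a′) xor (b ∧ c′) xor (c ∧ b′) ⟩

0𝔸 1𝔸 εᵣ εᵣε꜀ : 𝔸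
0𝔸   = ⟨ false , false , false , false ⟩
1𝔸   = ⟨ true  , false , false , false ⟩
εᵣ   = ⟨ false , true  , false , false ⟩
εᵣε꜀ = ⟨ false , false , false , true  ⟩

_·_ : Bool → 𝔸 → 𝔸
false · x = 0𝔸
true  · x = x

·-congᵗ : ∀ b {x y} → (b ≡ true → x ≡ y) → b · x ≡ b · y
·-congᵗ false _   = refl
·-congᵗ true  x≡y = x≡y refl

coeff : Bool → Bool → 𝔸 → Bool
coeff false false ⟨ a , _ , _ , _ ⟩ = a
coeff false true  ⟨ _ , b , _ , _ ⟩ = b
coeff true  false ⟨ _ , _ , c , _ ⟩ = c
coeff true  true  ⟨ _ , _ , _ , d ⟩ = d

πᶜ ∂ᶜ : 𝔸 → 𝔸
πᶜ ⟨ a , b , _ , _ ⟩ = ⟨ a , b , false , false ⟩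
∂ᶜ ⟨ _ , _ , c , d ⟩ = ⟨ c , d , false , false ⟩

-- mono x p q stands for uˣ ηᵣᵖ η꜀ᵠ, where u² = 1 and ηᵣ² = η꜀² = 0; see weight.
data Monomial : Set where
  0ᵐ   : Monomial
  mono : Bool → Bool → Bool → Monomial

_⊗_ : Monomial → Monomial → Monomial
mono x p q ⊗ mono x′ p′ q′ = if p ∧ p′ ∨ q ∧ q′ then 0ᵐ else mono (x xor x′) (p ∨ p′) (q ∨ q′)
_          ⊗ _             = 0ᵐ

1ᵐ : Monomial
1ᵐ = mono false false false

vertex : Bool → Bool → Monomial
vertex r c = mono (r ∧ c) (r ∧ not c) (c ∧ not r)

-- The coefficient of εᵣᵃ ε꜀ᵇ in ⟦ weight R C ⟧ is the determinant of the minor of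
-- a blade on rows R and columns C bordered by a columns and b rows of ones (the
-- centre's column and row), and 0 if that matrix is not square.
⟦_⟧ : Monomial → 𝔸
⟦ 0ᵐ ⟧                 = 0𝔸
⟦ mono x false false ⟧ = if x then εᵣε꜀ else 1𝔸
⟦ mono _ true  false ⟧ = εᵣ
⟦ mono _ false true  ⟧ = ⟨ false , false , true , false ⟩
⟦ mono _ true  true  ⟧ = 1𝔸 ⊕ εᵣε꜀

∂₁ ∂₂ : Monomial → Monomial
∂₁ (mono true false q) = mono false true q
∂₁ _                   = 0ᵐ
∂₂ (mono x p true)     = mono x p false
∂₂ _                   = 0ᵐ

-- ⟦ y ⊗∂ z ⟧ sums ⟦ y ⊗ z′ ⟧ over the monomials z′ of z with one column deleted.
⟦_⊗∂_⟧ : Monomial → Monomial → 𝔸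
⟦ y ⊗∂ z ⟧ = ⟦ y ⊗ ∂₁ z ⟧ ⊕ ⟦ y ⊗ ∂₂ z ⟧

instance
  𝔸-exhaustible : Exhaustible 𝔸
  𝔸-exhaustible = retract (λ { ⟨ a , b , c , d ⟩ → a , b , c , d })
                          (λ (a , b , c , d) → ⟨ a , b , c , d ⟩)
                          (λ { ⟨ a , b , c , d ⟩ → refl })

  Monomial-exhaustible : Exhaustible Monomial
  Monomial-exhaustible = retract (λ { 0ᵐ → nothing ; (mono x p q) → just (x , p , q) })
                                 (λ { nothing → 0ᵐ ; (just (x , p , q)) → mono x p q })
                                 (λ { 0ᵐ → refl ; (mono x p q) → refl })

⊕-assoc : ∀ x y z → (x ⊕ y) ⊕ z ≡ x ⊕ (y ⊕ z)
⊕-assoc x y z = by-evaluation (λ (x , y , z) → (x ⊕ y) ⊕ z) (λ (x , y , z) → x ⊕ (y ⊕ z)) (x , y , z)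

⊕-identityˡ : ∀ x → 0𝔸 ⊕ x ≡ x
⊕-identityˡ = by-evaluation (0𝔸 ⊕_) (λ x → x)

⊕-identityʳ : ∀ x → x ⊕ 0𝔸 ≡ x
⊕-identityʳ = by-evaluation (_⊕ 0𝔸) (λ x → x)

⊛-assoc : ∀ x y z → (x ⊛ y) ⊛ z ≡ x ⊛ (y ⊛ z)
⊛-assoc x y z = by-evaluation (λ (x , y , z) → (x ⊛ y) ⊛ z) (λ (x , y , z) → x ⊛ (y ⊛ z)) (x , y , z)

⊛-identityˡ : ∀ x → 1𝔸 ⊛ x ≡ x
⊛-identityˡ = by-evaluation (1𝔸 ⊛_) (λ x → x)

⊛-swap : ∀ x y z → x ⊛ (y ⊛ z) ≡ y ⊛ (x ⊛ z)
⊛-swap x y z = by-evaluation (λ (x , y , z) → x ⊛ (y ⊛ z)) (λ (x , y , z) → y ⊛ (x ⊛ z)) (x , y , z)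

⊛-distribˡ : ∀ x y z → x ⊛ (y ⊕ z) ≡ x ⊛ y ⊕ x ⊛ z
⊛-distribˡ x y z = by-evaluation (λ (x , y , z) → x ⊛ (y ⊕ z)) (λ (x , y , z) → x ⊛ y ⊕ x ⊛ z) (x , y , z)

⊛-distribʳ : ∀ x y z → (y ⊕ z) ⊛ x ≡ y ⊛ x ⊕ z ⊛ x
⊛-distribʳ x y z = by-evaluation (λ (x , y , z) → (y ⊕ z) ⊛ x) (λ (x , y , z) → y ⊛ x ⊕ z ⊛ x) (x , y , z)

⊛-zeroˡ : ∀ x → 0𝔸 ⊛ x ≡ 0𝔸
⊛-zeroˡ = by-evaluation (0𝔸 ⊛_) (λ _ → 0𝔸)

⊛-zeroʳ : ∀ x → x ⊛ 0𝔸 ≡ 0𝔸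
⊛-zeroʳ = by-evaluation (_⊛ 0𝔸) (λ _ → 0𝔸)

·-⊛ˡ : ∀ b x y → b · x ⊛ y ≡ b · (x ⊛ y)
·-⊛ˡ b x y = by-evaluation (λ (b , x , y) → b · x ⊛ y) (λ (b , x , y) → b · (x ⊛ y)) (b , x , y)

·-⊛ʳ : ∀ b x y → y ⊛ b · x ≡ b · (y ⊛ x)
·-⊛ʳ b x y = by-evaluation (λ (b , x , y) → y ⊛ b · x) (λ (b , x , y) → b · (y ⊛ x)) (b , x , y)

πᶜ-⊕ : ∀ x y → πᶜ (x ⊕ y) ≡ πᶜ x ⊕ πᶜ y
πᶜ-⊕ x y = by-evaluation (λ (x , y) → πᶜ (x ⊕ y)) (λ (x , y) → πᶜ x ⊕ πᶜ y) (x , y)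

πᶜ-⊛ : ∀ x y → πᶜ (x ⊛ y) ≡ πᶜ (πᶜ x ⊛ πᶜ y)
πᶜ-⊛ x y = by-evaluation (λ (x , y) → πᶜ (x ⊛ y)) (λ (x , y) → πᶜ (πᶜ x ⊛ πᶜ y)) (x , y)

πᶜ-∂ᶜ-leibniz : ∀ x y → πᶜ (∂ᶜ x ⊛ y) ⊕ πᶜ (x ⊛ ∂ᶜ y) ≡ πᶜ (∂ᶜ (x ⊛ y))
πᶜ-∂ᶜ-leibniz x y = by-evaluation (λ (x , y) → πᶜ (∂ᶜ x ⊛ y) ⊕ πᶜ (x ⊛ ∂ᶜ y))
                                  (λ (x , y) → πᶜ (∂ᶜ (x ⊛ y))) (x , y)

coeff-⊕ : ∀ r c x y → coeff r c (x ⊕ y) ≡ coeff r c x xor coeff r c y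
coeff-⊕ r c x y = by-evaluation (λ (r , c , x , y) → coeff r c (x ⊕ y))
                                (λ (r , c , x , y) → coeff r c x xor coeff r c y) (r , c , x , y)

coeff-· : ∀ r c b x → coeff r c (b · x) ≡ b ∧ coeff r c x
coeff-· r c b x = by-evaluation (λ (r , c , b , x) → coeff r c (b · x))
                                (λ (r , c , b , x) → b ∧ coeff r c x) (r , c , b , x)

coeff-εᵣ : ∀ r c x → coeff r c (εᵣ ⊛ x) ≡ c ∧ coeff r false x
coeff-εᵣ r c x = by-evaluation (λ (r , c , x) → coeff r c (εᵣ ⊛ x))
                               (λ (r , c , x) → c ∧ coeff r false x) (r , c , x)

coeff-πᶜ : ∀ c x → coeff false c (πᶜ x) ≡ coeff false c x
coeff-πᶜ c x = by-evaluation (λ (c , x) → coeff false c (πᶜ x)) (λ (c , x) → coeff false c x) (c , x)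

coeff-∂ᶜ : ∀ c x → coeff false c (∂ᶜ x) ≡ coeff true c x
coeff-∂ᶜ c x = by-evaluation (λ (c , x) → coeff false c (∂ᶜ x)) (λ (c , x) → coeff true c x) (c , x)

⊗-identityˡ : ∀ y → 1ᵐ ⊗ y ≡ y
⊗-identityˡ = by-evaluation (1ᵐ ⊗_) (λ y → y)

⊗-assoc : ∀ x y z → (x ⊗ y) ⊗ z ≡ x ⊗ (y ⊗ z)
⊗-assoc x y z = by-evaluation (λ (x , y , z) → (x ⊗ y) ⊗ z) (λ (x , y , z) → x ⊗ (y ⊗ z)) (x , y , z)

⊗-comm : ∀ x y → x ⊗ y ≡ y ⊗ x
⊗-comm x y = by-evaluation (λ (x , y) → x ⊗ y) (λ (x , y) → y ⊗ x) (x , y)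

⊗-swap : ∀ x y z → x ⊗ (y ⊗ z) ≡ y ⊗ (x ⊗ z)
⊗-swap x y z = begin
  x ⊗ (y ⊗ z) ≡⟨ ⊗-assoc x y z ⟨
  x ⊗ y ⊗ z   ≡⟨ cong (_⊗ z) (⊗-comm x y) ⟩
  y ⊗ x ⊗ z   ≡⟨ ⊗-assoc y x z ⟩
  y ⊗ (x ⊗ z) ∎
  where open ≡-Reasoning

⊗∂-identityʳ : ∀ y → ⟦ y ⊗∂ 1ᵐ ⟧ ≡ 0𝔸
⊗∂-identityʳ = by-evaluation (λ y → ⟦ y ⊗∂ 1ᵐ ⟧) (λ _ → 0𝔸)

⊗∂-leibniz : ∀ y z r c →
  c · ⟦ y ⊗ (vertex r false ⊗ z) ⟧ ⊕ ⟦ y ⊗ vertex r c ⊗∂ z ⟧ ≡ ⟦ y ⊗∂ vertex r c ⊗ z ⟧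
⊗∂-leibniz y z r c =
  by-evaluation (λ (y , z , r , c) → c · ⟦ y ⊗ (vertex r false ⊗ z) ⟧ ⊕ ⟦ y ⊗ vertex r c ⊗∂ z ⟧)
                (λ (y , z , r , c) → ⟦ y ⊗∂ vertex r c ⊗ z ⟧) (y , z , r , c)

-- Expanding along a new row: its entry is 1 in the other columns of its blade
-- (the derivative) and in the centre column (εᵣ).
row-insertion : ∀ z c → ⟦ vertex false c ⊗∂ z ⟧ ⊕ εᵣ ⊛ ⟦ vertex false c ⊗ z ⟧ ≡ ⟦ vertex true c ⊗ z ⟧
row-insertion z c = by-evaluation (λ (z , c) → ⟦ vertex false c ⊗∂ z ⟧ ⊕ εᵣ ⊛ ⟦ vertex false c ⊗ z ⟧)
                                  (λ (z , c) → ⟦ vertex true c ⊗ z ⟧) (z , c)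

πᶜ-⊗∂ : ∀ z → πᶜ ⟦ 1ᵐ ⊗∂ z ⟧ ≡ πᶜ (∂ᶜ ⟦ z ⟧)
πᶜ-⊗∂ = by-evaluation (λ z → πᶜ ⟦ 1ᵐ ⊗∂ z ⟧) (λ z → πᶜ (∂ᶜ ⟦ z ⟧))

∑ : ∀ {n} → Vector 𝔸 n → 𝔸
∑ {zero}  f = 0𝔸
∑ {suc n} f = head f ⊕ ∑ (tail f)

∑-cong : ∀ {n} {f g : Vector 𝔸 n} → f ≗ g → ∑ f ≡ ∑ g
∑-cong {zero}  f≗g = refl
∑-cong {suc n} f≗g = cong₂ _⊕_ (f≗g zero) (∑-cong (f≗g ∘ suc))

∑-zero : ∀ {n} (f : Vector 𝔸 n) → (∀ i → f i ≡ 0𝔸) → ∑ f ≡ 0𝔸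
∑-zero {zero}  f f≡0 = refl
∑-zero {suc n} f f≡0 = trans (cong₂ _⊕_ (f≡0 zero) (∑-zero (tail f) (f≡0 ∘ suc))) (⊕-identityˡ 0𝔸)

∑-++ : ∀ k {n} (f : Vector 𝔸 (k ℕ.+ n)) → ∑ f ≡ ∑ (take k f) ⊕ ∑ (drop k f)
∑-++ zero    f = sym (⊕-identityˡ _)
∑-++ (suc k) f = trans (cong (head f ⊕_) (∑-++ k (tail f))) (sym (⊕-assoc (head f) _ _))

additive-∑ : ∀ {n} (φ : 𝔸 → 𝔸) → (∀ x y → φ (x ⊕ y) ≡ φ x ⊕ φ y) → φ 0𝔸 ≡ 0𝔸 →
             (f : Vector 𝔸 n) → ∑ (φ ∘ f) ≡ φ (∑ f)
additive-∑ {zero}  φ φ-⊕ φ-0 f = sym φ-0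
additive-∑ {suc n} φ φ-⊕ φ-0 f =
  trans (cong (φ (head f) ⊕_) (additive-∑ φ φ-⊕ φ-0 (tail f))) (sym (φ-⊕ _ _))

∑-⊛ʳ : ∀ {n} (b : Vector Bool n) (x : Vector 𝔸 n) y → ∑ (λ i → b i · (x i ⊛ y)) ≡ ∑ (λ i → b i · x i) ⊛ y
∑-⊛ʳ b x y = trans (∑-cong (λ i → sym (·-⊛ˡ (b i) (x i) y)))
                   (additive-∑ (_⊛ y) (⊛-distribʳ y) (⊛-zeroˡ y) (λ i → b i · x i))

∑-⊛ˡ : ∀ {n} (b : Vector Bool n) (x : Vector 𝔸 n) y → ∑ (λ i → b i · (y ⊛ x i)) ≡ y ⊛ ∑ (λ i → b i · x i)
∑-⊛ˡ b x y = trans (∑-cong (λ i → sym (·-⊛ʳ (b i) (x i) y)))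
                   (additive-∑ (y ⊛_) (⊛-distribˡ y) (⊛-zeroʳ y) (λ i → b i · x i))

coeff-∑ : ∀ {n} r c (f : Vector 𝔸 n) → coeff r c (∑ f) ≡ xorSum (coeff r c ∘ f)
coeff-∑ {zero}  false false f = refl
coeff-∑ {zero}  false true  f = refl
coeff-∑ {zero}  true  false f = refl
coeff-∑ {zero}  true  true  f = refl
coeff-∑ {suc n} r c f = trans (coeff-⊕ r c (head f) _) (cong (coeff r c (head f) xor_) (coeff-∑ r c (tail f)))

xorSum-cong : ∀ {n} {f g : Vector Bool n} → f ≗ g → xorSum f ≡ xorSum g
xorSum-cong {zero}  f≗g = refl
xorSum-cong {suc n} f≗g = cong₂ _xor_ (f≗g zero) (xorSum-cong (f≗g ∘ suc))

xorSum-false : ∀ {n} → xorSum {n} (λ _ → false) ≡ false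
xorSum-false {zero}  = refl
xorSum-false {suc n} = xorSum-false {n}

xorSum-xor : ∀ {n} (f g : Vector Bool n) → xorSum (λ i → f i xor g i) ≡ xorSum f xor xorSum g
xorSum-xor {zero}  f g = refl
xorSum-xor {suc n} f g = begin
  (f zero xor g zero) xor xorSum (λ i → f (suc i) xor g (suc i))
    ≡⟨ cong ((f zero xor g zero) xor_) (xorSum-xor (tail f) (tail g)) ⟩
  (f zero xor g zero) xor (xorSum (tail f) xor xorSum (tail g))
    ≡⟨ medial (f zero) (g zero) (xorSum (tail f)) (xorSum (tail g)) ⟩
  (f zero xor xorSum (tail f)) xor (g zero xor xorSum (tail g)) ∎
  where
  open ≡-Reasoning
  medial : ∀ a b c d → (a xor b) xor (c xor d) ≡ (a xor c) xor (b xor d)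
  medial a b c d = by-evaluation (λ (a , b , c , d) → (a xor b) xor (c xor d))
                                 (λ (a , b , c , d) → (a xor c) xor (b xor d)) (a , b , c , d)

infix 4 _==_
_==_ : ∀ {k} → Fin k → Fin k → Bool
a == b = does (a FinP.≟ b)

==-refl : ∀ {k} (a : Fin k) → (a == a) ≡ true
==-refl a = dec-true (a FinP.≟ a) refl

==-sym : ∀ {k} (a b : Fin k) → (a == b) ≡ (b == a)
==-sym zero    zero    = refl
==-sym zero    (suc b) = refl
==-sym (suc a) zero    = refl
==-sym (suc a) (suc b) = ==-sym a b

infixl 5 _∖_
_∖_ : ∀ {k} → Vector Bool k → Fin k → Vector Bool k
(R ∖ a) v = R v ∧ not (a == v)

∖-self : ∀ {k} (R : Vector Bool k) a → (R ∖ a) a ≡ false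
∖-self R a = trans (cong (λ t → R a ∧ not t) (==-refl a)) (∧-zeroʳ (R a))

∖-idem : ∀ {k} (R : Vector Bool k) a → R ∖ a ∖ a ≗ R ∖ a
∖-idem R a v = trans (BoolP.∧-assoc (R v) _ _) (cong (R v ∧_) (BoolP.∧-idem _))

∖-comm : ∀ {k} (R : Vector Bool k) a b → R ∖ a ∖ b ≗ R ∖ b ∖ a
∖-comm R a b v = by-evaluation (λ (r , s , t) → (r ∧ s) ∧ t) (λ (r , s , t) → (r ∧ t) ∧ s)
                               (R v , not (a == v) , not (b == v))

∖-member : ∀ {k} (R : Vector Bool k) {a v} → (R ∖ a) v ≡ true → (a == v) ≡ false
∖-member R {a} {v} v∈R∖a with R v | a == v
... | true | false = refl

∖-other : ∀ {k} (R : Vector Bool k) a b → (a == b) ≡ false → (R ∖ a) b ≡ R b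
∖-other R a b a≠b = trans (cong (λ t → R b ∧ not t) a≠b) (∧-identityʳ (R b))

-- In the minor of the clique J - I on rows R and columns C the rows of R ∖ C
-- consist of ones, so two of them make it vanish (and likewise for C ∖ R);
-- otherwise the bordered minors only depend on |R ∩ C| mod 2, R ∖ C and C ∖ R.
weight : ∀ {k} → Vector Bool k → Vector Bool k → Monomial
weight {zero}  R C = 1ᵐ
weight {suc k} R C = vertex (head R) (head C) ⊗ weight (tail R) (tail C)

weight-cong : ∀ {k} {R R′ C C′ : Vector Bool k} → R ≗ R′ → C ≗ C′ → weight R C ≡ weight R′ C′
weight-cong {zero}  R≗R′ C≗C′ = refl
weight-cong {suc k} R≗R′ C≗C′ =
  cong₂ _⊗_ (cong₂ vertex (R≗R′ zero) (C≗C′ zero)) (weight-cong (R≗R′ ∘ suc) (C≗C′ ∘ suc))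

weight-extract : ∀ {k} (R C : Vector Bool k) a → weight R C ≡ vertex (R a) (C a) ⊗ weight (R ∖ a) (C ∖ a)
weight-extract R C zero = cong (vertex (R zero) (C zero) ⊗_) (begin
  weight (tail R) (tail C)
    ≡⟨ ⊗-identityˡ _ ⟨
  1ᵐ ⊗ weight (tail R) (tail C)
    ≡⟨ cong₂ _⊗_ (cong₂ vertex (∧-zeroʳ (R zero)) (∧-zeroʳ (C zero)))
                 (weight-cong (λ v → ∖-other R zero (suc v) refl) (λ v → ∖-other C zero (suc v) refl)) ⟨
  weight (R ∖ zero) (C ∖ zero) ∎)
  where open ≡-Reasoning
weight-extract {suc k} R C (suc a) = begin
  h₀ ⊗ weight (tail R) (tail C)
    ≡⟨ cong (h₀ ⊗_) (weight-extract (tail R) (tail C) a) ⟩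
  h₀ ⊗ (vertex (R (suc a)) (C (suc a)) ⊗ weight (tail R ∖ a) (tail C ∖ a))
    ≡⟨ ⊗-swap h₀ (vertex (R (suc a)) (C (suc a))) (weight (tail R ∖ a) (tail C ∖ a)) ⟩
  vertex (R (suc a)) (C (suc a)) ⊗ (h₀ ⊗ weight (tail R ∖ a) (tail C ∖ a))
    ≡⟨ cong (λ h → vertex (R (suc a)) (C (suc a)) ⊗ (h ⊗ weight (tail R ∖ a) (tail C ∖ a)))
            (cong₂ vertex (∖-other R (suc a) zero refl) (∖-other C (suc a) zero refl)) ⟨
  vertex (R (suc a)) (C (suc a)) ⊗ weight (R ∖ suc a) (C ∖ suc a) ∎
  where
  open ≡-Reasoning
  h₀ = vertex (head R) (head C)

∑-delete-column : ∀ {k} y (R C : Vector Bool k) →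
                  ∑ (λ w → C w · ⟦ y ⊗ weight R (C ∖ w) ⟧) ≡ ⟦ y ⊗∂ weight R C ⟧
∑-delete-column {zero}  y R C = sym (⊗∂-identityʳ y)
∑-delete-column {suc k} y R C = begin
  C zero · ⟦ y ⊗ weight R (C ∖ zero) ⟧ ⊕ ∑ (λ w → C (suc w) · ⟦ y ⊗ weight R (C ∖ suc w) ⟧)
    ≡⟨ cong₂ _⊕_ (cong (λ W → C zero · ⟦ y ⊗ W ⟧) first)
                 (∑-cong (λ w → cong (λ W → C (suc w) · ⟦ W ⟧) (rest w))) ⟩
  C zero · ⟦ y ⊗ (vertex (R zero) false ⊗ W) ⟧ ⊕ ∑ (λ w → tail C w · ⟦ y ⊗ h₀ ⊗ weight (tail R) (tail C ∖ w) ⟧)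
    ≡⟨ cong (C zero · ⟦ y ⊗ (vertex (R zero) false ⊗ W) ⟧ ⊕_) (∑-delete-column (y ⊗ h₀) (tail R) (tail C)) ⟩
  C zero · ⟦ y ⊗ (vertex (R zero) false ⊗ W) ⟧ ⊕ ⟦ y ⊗ h₀ ⊗∂ W ⟧
    ≡⟨ ⊗∂-leibniz y W (R zero) (C zero) ⟩
  ⟦ y ⊗∂ weight R C ⟧ ∎
  where
  open ≡-Reasoning
  h₀ = vertex (R zero) (C zero)
  W  = weight (tail R) (tail C)
  first : weight R (C ∖ zero) ≡ vertex (R zero) false ⊗ W
  first = cong₂ _⊗_ (cong (vertex (R zero)) (∧-zeroʳ (C zero)))
                    (weight-cong (λ _ → refl) (λ v → ∖-other C zero (suc v) refl))
  rest : ∀ w → y ⊗ weight R (C ∖ suc w) ≡ y ⊗ h₀ ⊗ weight (tail R) (tail C ∖ w)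
  rest w = trans (cong (λ c → y ⊗ (vertex (R zero) c ⊗ weight (tail R) (tail C ∖ w)))
                       (∖-other C (suc w) zero refl))
                 (sym (⊗-assoc y h₀ (weight (tail R) (tail C ∖ w))))

-- Laplace expansion along the row of a blade vertex a: its entries are 1 in the
-- other columns of the blade and in the centre column.
bladeRowExpansion : ∀ {k} → Vector Bool k → Vector Bool k → Fin k → 𝔸
bladeRowExpansion R C a = ∑ (λ w → (C ∖ a) w · ⟦ weight (R ∖ a) (C ∖ w) ⟧) ⊕ εᵣ ⊛ ⟦ weight (R ∖ a) C ⟧

blade-row-expansion : ∀ {k} (R C : Vector Bool k) a → R a ≡ true → bladeRowExpansion R C a ≡ ⟦ weight R C ⟧
blade-row-expansion R C a Ra = begin
  ∑ (λ w → (C ∖ a) w · ⟦ weight (R ∖ a) (C ∖ w) ⟧) ⊕ εᵣ ⊛ ⟦ weight (R ∖ a) C ⟧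
    ≡⟨ cong₂ (λ s W → s ⊕ εᵣ ⊛ ⟦ W ⟧) (∑-cong term) (extract-a C) ⟩
  ∑ (λ w → (C ∖ a) w · ⟦ v ⊗ weight (R ∖ a) (C ∖ a ∖ w) ⟧) ⊕ εᵣ ⊛ ⟦ v ⊗ Z ⟧
    ≡⟨ cong (_⊕ εᵣ ⊛ ⟦ v ⊗ Z ⟧) (∑-delete-column v (R ∖ a) (C ∖ a)) ⟩
  ⟦ v ⊗∂ Z ⟧ ⊕ εᵣ ⊛ ⟦ v ⊗ Z ⟧
    ≡⟨ row-insertion Z (C a) ⟩
  ⟦ vertex true (C a) ⊗ Z ⟧
    ≡⟨ cong (λ r → ⟦ vertex r (C a) ⊗ Z ⟧) Ra ⟨
  ⟦ vertex (R a) (C a) ⊗ Z ⟧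
    ≡⟨ cong ⟦_⟧ (weight-extract R C a) ⟨
  ⟦ weight R C ⟧ ∎
  where
  open ≡-Reasoning
  v = vertex false (C a)
  Z = weight (R ∖ a) (C ∖ a)
  extract-a : ∀ C′ → weight (R ∖ a) C′ ≡ vertex false (C′ a) ⊗ weight (R ∖ a) (C′ ∖ a)
  extract-a C′ = trans (weight-extract (R ∖ a) C′ a)
                       (cong₂ (λ r W → vertex r (C′ a) ⊗ W) (∖-self R a) (weight-cong (∖-idem R a) (λ _ → refl)))
  term : ∀ w → (C ∖ a) w · ⟦ weight (R ∖ a) (C ∖ w) ⟧ ≡ (C ∖ a) w · ⟦ v ⊗ weight (R ∖ a) (C ∖ a ∖ w) ⟧
  term w = ·-congᵗ ((C ∖ a) w) λ w∈C∖a → cong ⟦_⟧ (trans (extract-a (C ∖ w))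
    (cong₂ (λ c W → vertex false c ⊗ W)
           (∖-other C w a (trans (==-sym w a) (∖-member C {a} {w} w∈C∖a)))
           (weight-cong (λ _ → refl) (∖-comm C w a))))

blade-column-expansion : ∀ {k} (R C : Vector Bool k) →
                         ∑ (λ w → C w · ⟦ weight R (C ∖ w) ⟧) ≡ ⟦ 1ᵐ ⊗∂ weight R C ⟧
blade-column-expansion R C =
  trans (∑-cong (λ w → cong (λ W → C w · ⟦ W ⟧) (sym (⊗-identityˡ (weight R (C ∖ w))))))
        (∑-delete-column 1ᵐ R C)

data SplitView (k n : ℕ) : Fin (k ℕ.+ n) → Set where
  inˡ : (i : Fin k) → SplitView k n (i ↑ˡ n)
  inʳ : (j : Fin n) → SplitView k n (k ↑ʳ j)

splitView : ∀ k n a → SplitView k n a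
splitView zero    n a       = inʳ a
splitView (suc k) n zero    = inˡ zero
splitView (suc k) n (suc a) with splitView k n a
... | inˡ i = inˡ (suc i)
... | inʳ j = inʳ j

==-↑ˡ : ∀ {k} n (i j : Fin k) → (i ↑ˡ n == j ↑ˡ n) ≡ (i == j)
==-↑ˡ n zero    zero    = refl
==-↑ˡ n zero    (suc j) = refl
==-↑ˡ n (suc i) zero    = refl
==-↑ˡ n (suc i) (suc j) = ==-↑ˡ n i j

==-↑ʳ : ∀ k {n} (i j : Fin n) → (k ↑ʳ i == k ↑ʳ j) ≡ (i == j)
==-↑ʳ zero    i j = refl
==-↑ʳ (suc k) i j = ==-↑ʳ k i j

==-↑ˡʳ : ∀ {k} n (i : Fin k) j → (i ↑ˡ n == k ↑ʳ j) ≡ false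
==-↑ˡʳ n zero    j = refl
==-↑ˡʳ n (suc i) j = ==-↑ˡʳ n i j

module _ (k : ℕ) {n : ℕ} (R : Vector Bool (k ℕ.+ n)) where

  take-∖ˡ : ∀ i → take k (R ∖ (i ↑ˡ n)) ≗ take k R ∖ i
  take-∖ˡ i j = cong (λ t → R (j ↑ˡ n) ∧ not t) (==-↑ˡ n i j)

  drop-∖ˡ : ∀ i → drop k (R ∖ (i ↑ˡ n)) ≗ drop k R
  drop-∖ˡ i j = ∖-other R (i ↑ˡ n) (k ↑ʳ j) (==-↑ˡʳ n i j)

  take-∖ʳ : ∀ j → take k (R ∖ (k ↑ʳ j)) ≗ take k R
  take-∖ʳ j i = ∖-other R (k ↑ʳ j) (i ↑ˡ n) (trans (==-sym (k ↑ʳ j) (i ↑ˡ n)) (==-↑ˡʳ n i j))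

  drop-∖ʳ : ∀ j → drop k (R ∖ (k ↑ʳ j)) ≗ drop k R ∖ j
  drop-∖ʳ j i = cong (λ t → R (k ↑ʳ i) ∧ not t) (==-↑ʳ k j i)

Ψ : ∀ K m → Vector Bool (m ℕ.* K) → Vector Bool (m ℕ.* K) → 𝔸
Ψ K zero    R C = 1𝔸
Ψ K (suc m) R C = ⟦ weight (take K R) (take K C) ⟧ ⊛ Ψ K m (drop K R) (drop K C)

Ψ-cong : ∀ K m {R R′ C C′ : Vector Bool (m ℕ.* K)} → R ≗ R′ → C ≗ C′ → Ψ K m R C ≡ Ψ K m R′ C′
Ψ-cong K zero    R≗R′ C≗C′ = refl
Ψ-cong K (suc m) R≗R′ C≗C′ =
  cong₂ _⊛_ (cong ⟦_⟧ (weight-cong (R≗R′ ∘ (_↑ˡ m ℕ.* K)) (C≗C′ ∘ (_↑ˡ m ℕ.* K))))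
            (Ψ-cong K m (R≗R′ ∘ (K ↑ʳ_)) (C≗C′ ∘ (K ↑ʳ_)))

adjacent : ∀ K m → Fin (m ℕ.* K) → Fin (m ℕ.* K) → Bool
adjacent K m a b = windmill (suc K) m (suc a) (suc b)

module _ (K m : ℕ) where

  adjacent-↑ˡ : ∀ i j → adjacent K (suc m) (i ↑ˡ (m ℕ.* K)) (j ↑ˡ (m ℕ.* K)) ≡ not (i == j)
  adjacent-↑ˡ i j rewrite FinP.splitAt-↑ˡ K i (m ℕ.* K) | FinP.splitAt-↑ˡ K j (m ℕ.* K) = refl

  adjacent-↑ʳ : ∀ i j → adjacent K (suc m) (K ↑ʳ i) (K ↑ʳ j) ≡ adjacent K m i j
  adjacent-↑ʳ i j rewrite FinP.splitAt-↑ʳ K (m ℕ.* K) i | FinP.splitAt-↑ʳ K (m ℕ.* K) j = refl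

  adjacent-↑ˡʳ : ∀ i j → adjacent K (suc m) (i ↑ˡ (m ℕ.* K)) (K ↑ʳ j) ≡ false
  adjacent-↑ˡʳ i j rewrite FinP.splitAt-↑ˡ K i (m ℕ.* K) | FinP.splitAt-↑ʳ K (m ℕ.* K) j = refl

  adjacent-↑ʳˡ : ∀ j i → adjacent K (suc m) (K ↑ʳ j) (i ↑ˡ (m ℕ.* K)) ≡ false
  adjacent-↑ʳˡ j i rewrite FinP.splitAt-↑ˡ K i (m ℕ.* K) | FinP.splitAt-↑ʳ K (m ℕ.* K) j = refl

module _ {n : ℕ} (b : Vector Bool n) (x : Vector 𝔸 n) (y z : 𝔸) where

  expansion-⊛ʳ : ∑ (λ j → b j · (x j ⊛ y)) ⊕ εᵣ ⊛ (z ⊛ y) ≡ (∑ (λ j → b j · x j) ⊕ εᵣ ⊛ z) ⊛ y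
  expansion-⊛ʳ = begin
    ∑ (λ j → b j · (x j ⊛ y)) ⊕ εᵣ ⊛ (z ⊛ y) ≡⟨ cong₂ _⊕_ (∑-⊛ʳ b x y) (sym (⊛-assoc εᵣ z y)) ⟩
    ∑ (λ j → b j · x j) ⊛ y ⊕ εᵣ ⊛ z ⊛ y      ≡⟨ ⊛-distribʳ y _ _ ⟨
    (∑ (λ j → b j · x j) ⊕ εᵣ ⊛ z) ⊛ y        ∎
    where open ≡-Reasoning

  expansion-⊛ˡ : ∑ (λ j → b j · (y ⊛ x j)) ⊕ εᵣ ⊛ (y ⊛ z) ≡ y ⊛ (∑ (λ j → b j · x j) ⊕ εᵣ ⊛ z)
  expansion-⊛ˡ = begin
    ∑ (λ j → b j · (y ⊛ x j)) ⊕ εᵣ ⊛ (y ⊛ z) ≡⟨ cong₂ _⊕_ (∑-⊛ˡ b x y) (⊛-swap εᵣ y z) ⟩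
    y ⊛ ∑ (λ j → b j · x j) ⊕ y ⊛ (εᵣ ⊛ z)    ≡⟨ ⊛-distribˡ y _ _ ⟨
    y ⊛ (∑ (λ j → b j · x j) ⊕ εᵣ ⊛ z)        ∎
    where open ≡-Reasoning

∑-vanishing : ∀ {n} (b : Vector Bool n) (x : Vector 𝔸 n) → (∀ j → b j ≡ false) → ∑ (λ j → b j · x j) ≡ 0𝔸
∑-vanishing b x b≡false = ∑-zero _ (λ j → cong (_· x j) (b≡false j))

rowExpansion : ∀ K m → Vector Bool (m ℕ.* K) → Vector Bool (m ℕ.* K) → Fin (m ℕ.* K) → 𝔸
rowExpansion K m R C a = ∑ (λ w → (C w ∧ adjacent K m a w) · Ψ K m (R ∖ a) (C ∖ w)) ⊕ εᵣ ⊛ Ψ K m (R ∖ a) C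

module _ (K m : ℕ) (R C : Vector Bool (suc m ℕ.* K)) where

  rowExpansion-↑ˡ : ∀ i → rowExpansion K (suc m) R C (i ↑ˡ m ℕ.* K)
                          ≡ bladeRowExpansion (take K R) (take K C) i ⊛ Ψ K m (drop K R) (drop K C)
  rowExpansion-↑ˡ i = begin
    rowExpansion K (suc m) R C a
      ≡⟨ cong₂ _⊕_ (trans (∑-++ K _) (cong₂ _⊕_ (∑-cong same-blade) (∑-vanishing _ _ other-blades)))
                   (cong (εᵣ ⊛_) (Ψ-∖ C λ _ → refl)) ⟩
    (∑ (λ j → (take K C ∖ i) j · (⟦ weight (take K R ∖ i) (take K C ∖ j) ⟧ ⊛ Ψ′)) ⊕ 0𝔸)
      ⊕ εᵣ ⊛ (⟦ weight (take K R ∖ i) (take K C) ⟧ ⊛ Ψ′)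
      ≡⟨ cong (_⊕ εᵣ ⊛ (⟦ weight (take K R ∖ i) (take K C) ⟧ ⊛ Ψ′)) (⊕-identityʳ _) ⟩
    ∑ (λ j → (take K C ∖ i) j · (⟦ weight (take K R ∖ i) (take K C ∖ j) ⟧ ⊛ Ψ′))
      ⊕ εᵣ ⊛ (⟦ weight (take K R ∖ i) (take K C) ⟧ ⊛ Ψ′)
      ≡⟨ expansion-⊛ʳ (take K C ∖ i) (λ j → ⟦ weight (take K R ∖ i) (take K C ∖ j) ⟧) Ψ′ _ ⟩
    bladeRowExpansion (take K R) (take K C) i ⊛ Ψ′ ∎
    where
    open ≡-Reasoning
    a  = i ↑ˡ m ℕ.* K
    Ψ′ = Ψ K m (drop K R) (drop K C)
    Ψ-∖ : ∀ C′ → drop K C′ ≗ drop K C →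
          Ψ K (suc m) (R ∖ a) C′ ≡ ⟦ weight (take K R ∖ i) (take K C′) ⟧ ⊛ Ψ′
    Ψ-∖ C′ C′≗C = cong₂ _⊛_ (cong ⟦_⟧ (weight-cong (take-∖ˡ K R i) (λ _ → refl)))
                            (Ψ-cong K m (drop-∖ˡ K R i) C′≗C)
    same-blade : ∀ j → (C (j ↑ˡ _) ∧ adjacent K (suc m) a (j ↑ˡ _)) · Ψ K (suc m) (R ∖ a) (C ∖ (j ↑ˡ _))
                     ≡ (take K C ∖ i) j · (⟦ weight (take K R ∖ i) (take K C ∖ j) ⟧ ⊛ Ψ′)
    same-blade j = cong₂ _·_ (cong (C (j ↑ˡ _) ∧_) (adjacent-↑ˡ K m i j))
      (trans (Ψ-∖ (C ∖ (j ↑ˡ _)) (drop-∖ˡ K C j))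
             (cong (λ W → ⟦ W ⟧ ⊛ Ψ′) (weight-cong (λ _ → refl) (take-∖ˡ K C j))))
    other-blades : ∀ j → C (K ↑ʳ j) ∧ adjacent K (suc m) a (K ↑ʳ j) ≡ false
    other-blades j = trans (cong (C (K ↑ʳ j) ∧_) (adjacent-↑ˡʳ K m i j)) (∧-zeroʳ _)

  rowExpansion-↑ʳ : ∀ a′ → rowExpansion K (suc m) R C (K ↑ʳ a′)
                           ≡ ⟦ weight (take K R) (take K C) ⟧ ⊛ rowExpansion K m (drop K R) (drop K C) a′
  rowExpansion-↑ʳ a′ = begin
    rowExpansion K (suc m) R C a
      ≡⟨ cong₂ _⊕_ (trans (∑-++ K _) (cong₂ _⊕_ (∑-vanishing _ _ other-blades) (∑-cong same-blade)))
                   (cong (εᵣ ⊛_) (Ψ-∖ C λ _ → refl)) ⟩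
    (0𝔸 ⊕ ∑ (λ j → (drop K C j ∧ adjacent K m a′ j) · (P ⊛ Ψ K m (drop K R ∖ a′) (drop K C ∖ j))))
      ⊕ εᵣ ⊛ (P ⊛ Ψ K m (drop K R ∖ a′) (drop K C))
      ≡⟨ cong (_⊕ εᵣ ⊛ (P ⊛ Ψ K m (drop K R ∖ a′) (drop K C))) (⊕-identityˡ _) ⟩
    ∑ (λ j → (drop K C j ∧ adjacent K m a′ j) · (P ⊛ Ψ K m (drop K R ∖ a′) (drop K C ∖ j)))
      ⊕ εᵣ ⊛ (P ⊛ Ψ K m (drop K R ∖ a′) (drop K C))
      ≡⟨ expansion-⊛ˡ (λ j → drop K C j ∧ adjacent K m a′ j) (λ j → Ψ K m (drop K R ∖ a′) (drop K C ∖ j)) P _ ⟩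
    P ⊛ rowExpansion K m (drop K R) (drop K C) a′ ∎
    where
    open ≡-Reasoning
    a = K ↑ʳ a′
    P = ⟦ weight (take K R) (take K C) ⟧
    Ψ-∖ : ∀ C′ → take K C′ ≗ take K C →
          Ψ K (suc m) (R ∖ a) C′ ≡ P ⊛ Ψ K m (drop K R ∖ a′) (drop K C′)
    Ψ-∖ C′ C′≗C = cong₂ _⊛_ (cong ⟦_⟧ (weight-cong (take-∖ʳ K R a′) C′≗C))
                            (Ψ-cong K m (drop-∖ʳ K R a′) (λ _ → refl))
    same-blade : ∀ j → (C (K ↑ʳ j) ∧ adjacent K (suc m) a (K ↑ʳ j)) · Ψ K (suc m) (R ∖ a) (C ∖ (K ↑ʳ j))
                     ≡ (drop K C j ∧ adjacent K m a′ j) · (P ⊛ Ψ K m (drop K R ∖ a′) (drop K C ∖ j))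
    same-blade j = cong₂ _·_ (cong (C (K ↑ʳ j) ∧_) (adjacent-↑ʳ K m a′ j))
      (trans (Ψ-∖ (C ∖ (K ↑ʳ j)) (take-∖ʳ K C j))
             (cong (P ⊛_) (Ψ-cong K m (λ _ → refl) (drop-∖ʳ K C j))))
    other-blades : ∀ j → C (j ↑ˡ _) ∧ adjacent K (suc m) a (j ↑ˡ _) ≡ false
    other-blades j = trans (cong (C (j ↑ˡ _) ∧_) (adjacent-↑ʳˡ K m a′ j)) (∧-zeroʳ _)

Ψ-row-expansion : ∀ K m (R C : Vector Bool (m ℕ.* K)) a → R a ≡ true → rowExpansion K m R C a ≡ Ψ K m R C
Ψ-row-expansion K (suc m) R C a Rₐ with splitView K (m ℕ.* K) a
... | inˡ i  = trans (rowExpansion-↑ˡ K m R C i)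
                     (cong (_⊛ Ψ K m (drop K R) (drop K C)) (blade-row-expansion (take K R) (take K C) i Rₐ))
... | inʳ a′ = trans (rowExpansion-↑ʳ K m R C a′)
                     (cong (⟦ weight (take K R) (take K C) ⟧ ⊛_) (Ψ-row-expansion K m (drop K R) (drop K C) a′ Rₐ))

πᶜ-⊛-congˡ : ∀ {x x′} y → πᶜ x ≡ πᶜ x′ → πᶜ (x ⊛ y) ≡ πᶜ (x′ ⊛ y)
πᶜ-⊛-congˡ {x} {x′} y eq = trans (πᶜ-⊛ x y) (trans (cong (λ t → πᶜ (t ⊛ πᶜ y)) eq) (sym (πᶜ-⊛ x′ y)))

πᶜ-⊛-congʳ : ∀ x {y y′} → πᶜ y ≡ πᶜ y′ → πᶜ (x ⊛ y) ≡ πᶜ (x ⊛ y′)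
πᶜ-⊛-congʳ x {y} {y′} eq = trans (πᶜ-⊛ x y) (trans (cong (λ t → πᶜ (πᶜ x ⊛ t)) eq) (sym (πᶜ-⊛ x y′)))

-- Expanding along the centre row, whose entries are 1 in every blade column,
-- removes its marker ε꜀: modulo ε꜀, deleting a column is differentiation in ε꜀.
Ψ-column-expansion : ∀ K m (R C : Vector Bool (m ℕ.* K)) →
                     πᶜ (∑ (λ w → C w · Ψ K m R (C ∖ w))) ≡ πᶜ (∂ᶜ (Ψ K m R C))
Ψ-column-expansion K zero    R C = refl
Ψ-column-expansion K (suc m) R C = begin
  πᶜ (∑ (λ w → C w · Ψ K (suc m) R (C ∖ w)))
    ≡⟨ cong πᶜ (trans (∑-++ K _) (cong₂ _⊕_ (∑-cong first-blade) (∑-cong other-blades))) ⟩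
  πᶜ (∑ (λ j → take K C j · (⟦ weight (take K R) (take K C ∖ j) ⟧ ⊛ Ψ′))
      ⊕ ∑ (λ j → drop K C j · (P ⊛ Ψ K m (drop K R) (drop K C ∖ j))))
    ≡⟨ cong πᶜ (cong₂ _⊕_ (∑-⊛ʳ (take K C) (λ j → ⟦ weight (take K R) (take K C ∖ j) ⟧) Ψ′)
                          (∑-⊛ˡ (drop K C) (λ j → Ψ K m (drop K R) (drop K C ∖ j)) P)) ⟩
  πᶜ (∑ (λ j → take K C j · ⟦ weight (take K R) (take K C ∖ j) ⟧) ⊛ Ψ′
      ⊕ P ⊛ ∑ (λ j → drop K C j · Ψ K m (drop K R) (drop K C ∖ j)))
    ≡⟨ πᶜ-⊕ _ _ ⟩
  πᶜ (∑ (λ j → take K C j · ⟦ weight (take K R) (take K C ∖ j) ⟧) ⊛ Ψ′)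
    ⊕ πᶜ (P ⊛ ∑ (λ j → drop K C j · Ψ K m (drop K R) (drop K C ∖ j)))
    ≡⟨ cong₂ _⊕_
         (πᶜ-⊛-congˡ Ψ′ (trans (cong πᶜ (blade-column-expansion (take K R) (take K C)))
                               (πᶜ-⊗∂ (weight (take K R) (take K C)))))
         (πᶜ-⊛-congʳ P (Ψ-column-expansion K m (drop K R) (drop K C))) ⟩
  πᶜ (∂ᶜ P ⊛ Ψ′) ⊕ πᶜ (P ⊛ ∂ᶜ Ψ′)
    ≡⟨ πᶜ-∂ᶜ-leibniz P Ψ′ ⟩
  πᶜ (∂ᶜ (Ψ K (suc m) R C)) ∎
  where
  open ≡-Reasoning
  P  = ⟦ weight (take K R) (take K C) ⟧
  Ψ′ = Ψ K m (drop K R) (drop K C)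
  first-blade : ∀ j → C (j ↑ˡ _) · Ψ K (suc m) R (C ∖ (j ↑ˡ _))
                    ≡ take K C j · (⟦ weight (take K R) (take K C ∖ j) ⟧ ⊛ Ψ′)
  first-blade j = cong (C (j ↑ˡ _) ·_)
    (cong₂ _⊛_ (cong ⟦_⟧ (weight-cong (λ _ → refl) (take-∖ˡ K C j))) (Ψ-cong K m (λ _ → refl) (drop-∖ˡ K C j)))
  other-blades : ∀ j → C (K ↑ʳ j) · Ψ K (suc m) R (C ∖ (K ↑ʳ j))
                     ≡ drop K C j · (P ⊛ Ψ K m (drop K R) (drop K C ∖ j))
  other-blades j = cong (C (K ↑ʳ j) ·_)
    (cong₂ _⊛_ (cong ⟦_⟧ (weight-cong (λ _ → refl) (take-∖ʳ K C j))) (Ψ-cong K m (λ _ → refl) (drop-∖ʳ K C j)))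

-- Minors of the adjacency matrix

coeff-∑· : ∀ {n} r c (b : Vector Bool n) (x : Vector 𝔸 n) →
           xorSum (λ w → b w ∧ coeff r c (x w)) ≡ coeff r c (∑ (λ w → b w · x w))
coeff-∑· r c b x = trans (xorSum-cong (λ w → sym (coeff-· r c (b w) (x w)))) (sym (coeff-∑ r c (λ w → b w · x w)))

module _ (K m : ℕ) where

  private
    N : ℕ
    N = suc (m ℕ.* K)

  -- The centre row and column are the ε꜀ and εᵣ of the algebra.
  Φ : Vector Bool N → Vector Bool N → Bool
  Φ R C = coeff (head R) (head C) (Ψ K m (tail R) (tail C))

  Φ-cong : ∀ {R R′ C C′ : Vector Bool N} → R ≗ R′ → C ≗ C′ → Φ R C ≡ Φ R′ C′
  Φ-cong R≗R′ C≗C′ = cong₂ (λ (r , c) x → coeff r c x) (cong₂ _,_ (R≗R′ zero) (C≗C′ zero))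
                           (Ψ-cong K m (R≗R′ ∘ suc) (C≗C′ ∘ suc))

  Φ-centre-row-expansion : ∀ (R C : Vector Bool N) → R zero ≡ true →
    xorSum (λ v → C v ∧ (windmill (suc K) m zero v ∧ Φ (R ∖ zero) (C ∖ v))) ≡ Φ R C
  Φ-centre-row-expansion R C R₀ = begin
    (C zero ∧ false) xor xorSum (λ w → tail C w ∧ (true ∧ Φ (R ∖ zero) (C ∖ suc w)))
      ≡⟨ cong₂ _xor_ (∧-zeroʳ (C zero)) (xorSum-cong λ w → cong (tail C w ∧_)
           (cong₂ (λ r c → coeff r c (Ψ K m (tail (R ∖ zero)) (tail C ∖ w)))
                  (∧-zeroʳ (R zero)) (∧-identityʳ (C zero)))) ⟩
    xorSum (λ w → tail C w ∧ coeff false (C zero) (Ψ K m (tail (R ∖ zero)) (tail C ∖ w)))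
      ≡⟨ xorSum-cong (λ w → cong (λ Ψ′ → tail C w ∧ coeff false (C zero) Ψ′)
           (Ψ-cong K m (λ v → ∖-other R zero (suc v) refl) (λ _ → refl))) ⟩
    xorSum (λ w → tail C w ∧ coeff false (C zero) (Ψ K m (tail R) (tail C ∖ w)))
      ≡⟨ coeff-∑· false (C zero) (tail C) (λ w → Ψ K m (tail R) (tail C ∖ w)) ⟩
    coeff false (C zero) (∑ (λ w → tail C w · Ψ K m (tail R) (tail C ∖ w)))
      ≡⟨ coeff-πᶜ (C zero) _ ⟨
    coeff false (C zero) (πᶜ (∑ (λ w → tail C w · Ψ K m (tail R) (tail C ∖ w))))
      ≡⟨ cong (coeff false (C zero)) (Ψ-column-expansion K m (tail R) (tail C)) ⟩
    coeff false (C zero) (πᶜ (∂ᶜ (Ψ K m (tail R) (tail C))))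
      ≡⟨ trans (coeff-πᶜ (C zero) _) (coeff-∂ᶜ (C zero) _) ⟩
    coeff true (C zero) (Ψ K m (tail R) (tail C))
      ≡⟨ cong (λ r → coeff r (C zero) (Ψ K m (tail R) (tail C))) R₀ ⟨
    Φ R C ∎
    where open ≡-Reasoning

  Φ-blade-row-expansion : ∀ (R C : Vector Bool N) a → R (suc a) ≡ true →
    xorSum (λ v → C v ∧ (windmill (suc K) m (suc a) v ∧ Φ (R ∖ suc a) (C ∖ v))) ≡ Φ R C
  Φ-blade-row-expansion R C a Rₐ = begin
    (C zero ∧ (true ∧ Φ (R ∖ suc a) (C ∖ zero)))
      xor xorSum (λ w → tail C w ∧ (adjacent K m a w ∧ Φ (R ∖ suc a) (C ∖ suc w)))
      ≡⟨ cong₂ _xor_ centre-column blade-columns ⟩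
    (C zero ∧ coeff r false Q) xor coeff r c S
      ≡⟨ BoolP.xor-comm (C zero ∧ coeff r false Q) (coeff r c S) ⟩
    coeff r c S xor (C zero ∧ coeff r false Q)
      ≡⟨ cong (coeff r c S xor_) (coeff-εᵣ r c Q) ⟨
    coeff r c S xor coeff r c (εᵣ ⊛ Q)
      ≡⟨ coeff-⊕ r c S (εᵣ ⊛ Q) ⟨
    coeff r c (rowExpansion K m (tail R) (tail C) a)
      ≡⟨ cong (coeff r c) (Ψ-row-expansion K m (tail R) (tail C) a Rₐ) ⟩
    Φ R C ∎
    where
    open ≡-Reasoning
    r = R zero
    c = C zero
    Q = Ψ K m (tail R ∖ a) (tail C)
    S = ∑ (λ w → (tail C w ∧ adjacent K m a w) · Ψ K m (tail R ∖ a) (tail C ∖ w))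
    centre-column : C zero ∧ (true ∧ Φ (R ∖ suc a) (C ∖ zero)) ≡ C zero ∧ coeff r false Q
    centre-column = cong (C zero ∧_) (trans
      (cong₂ (λ r′ c′ → coeff r′ c′ (Ψ K m (tail R ∖ a) (tail (C ∖ zero)))) (∧-identityʳ r) (∧-zeroʳ c))
      (cong (coeff r false) (Ψ-cong K m (λ _ → refl) (λ v → ∖-other C zero (suc v) refl))))
    blade-columns : xorSum (λ w → tail C w ∧ (adjacent K m a w ∧ Φ (R ∖ suc a) (C ∖ suc w))) ≡ coeff r c S
    blade-columns = trans (xorSum-cong λ w → trans (sym (BoolP.∧-assoc (tail C w) _ _))
                            (cong (λ (r′ , c′) → (tail C w ∧ adjacent K m a w) ∧ coeff r′ c′ (Ψ K m (tail R ∖ a) (tail C ∖ w)))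
                                  (cong₂ _,_ (∧-identityʳ r) (∧-identityʳ c))))
                          (coeff-∑· r c (λ w → tail C w ∧ adjacent K m a w) (λ w → Ψ K m (tail R ∖ a) (tail C ∖ w)))

  Φ-row-expansion : ∀ (R C : Vector Bool N) r → R r ≡ true →
    xorSum (λ v → C v ∧ (windmill (suc K) m r v ∧ Φ (R ∖ r) (C ∖ v))) ≡ Φ R C
  Φ-row-expansion R C zero    = Φ-centre-row-expansion R C
  Φ-row-expansion R C (suc a) = Φ-blade-row-expansion R C a

==⇒≡ : ∀ {k} {a b : Fin k} → (a == b) ≡ true → a ≡ b
==⇒≡ {a = a} {b} eq with a FinP.≟ b
... | yes a≡b = a≡b

≢⇒== : ∀ {k} {a b : Fin k} → a ≢ b → (a == b) ≡ false
≢⇒== {a = a} {b} = dec-false (a FinP.≟ b)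

any : ∀ {n} → Vector Bool n → Bool
any = foldr _∨_ false

any-false : ∀ {n} (g : Vector Bool n) → (∀ i → g i ≡ false) → any g ≡ false
any-false {zero}  g g≡false = refl
any-false {suc n} g g≡false = cong₂ _∨_ (g≡false zero) (any-false (tail g) (g≡false ∘ suc))

any-punchIn : ∀ {n} (l : Fin (suc n)) (g : Vector Bool (suc n)) → any g ≡ g l ∨ any (g ∘ punchIn l)
any-punchIn zero    g = refl
any-punchIn {suc n} (suc l) g = trans (cong (g zero ∨_) (any-punchIn l (tail g))) (∨-swap (g zero) (g (suc l)) _)
  where ∨-swap : ∀ a b c → a ∨ (b ∨ c) ≡ b ∨ (a ∨ c)
        ∨-swap a b c = by-evaluation (λ (a , b , c) → a ∨ (b ∨ c)) (λ (a , b , c) → b ∨ (a ∨ c)) (a , b , c)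

image : ∀ {j n} → (Fin j → Fin n) → Vector Bool n
image f v = any (λ l → f l == v)

module _ {j n : ℕ} (f : Fin (suc j) → Fin n) (f-inj : Injective _≡_ _≡_ f) where

  image-punchIn : ∀ l → image (f ∘ punchIn l) ≗ image f ∖ f l
  image-punchIn l v with f l == v in fl≡v
  ... | true  = trans (any-false _ λ i → ≢⇒== λ eq → FinP.punchInᵢ≢i l i (f-inj (trans eq (sym (==⇒≡ fl≡v)))))
                      (sym (∧-zeroʳ (image f v)))
  ... | false = sym (trans (∧-identityʳ (image f v))
                           (trans (any-punchIn l (λ i → f i == v)) (cong (_∨ image (f ∘ punchIn l) v) fl≡v)))

  image-head : ∀ v → (f zero == v) ≡ true → image (f ∘ suc) v ≡ false
  image-head v f₀≡v = any-false (λ i → f (suc i) == v) λ i →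
    ≢⇒== λ eq → FinP.0≢1+n (f-inj (trans (==⇒≡ f₀≡v) (sym eq)))

xorSum-indicator : ∀ {n} (a : Fin n) (G : Vector Bool n) → xorSum (λ v → (a == v) ∧ G v) ≡ G a
xorSum-indicator {suc n} zero    G = trans (cong (G zero xor_) (xorSum-false {n})) (BoolP.xor-identityʳ (G zero))
xorSum-indicator {suc n} (suc a) G = xorSum-indicator a (tail G)

xorSum-image : ∀ {j n} (f : Fin j → Fin n) → Injective _≡_ _≡_ f → (G : Vector Bool n) →
               xorSum (G ∘ f) ≡ xorSum (λ v → image f v ∧ G v)
xorSum-image {zero}  {n} f f-inj G = sym (xorSum-false {n})
xorSum-image {suc j} f f-inj G = begin
  G (f zero) xor xorSum (G ∘ f ∘ suc)
    ≡⟨ cong₂ _xor_ (xorSum-indicator (f zero) G) (sym (xorSum-image (f ∘ suc) (λ eq → FinP.suc-injective (f-inj eq)) G)) ⟨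
  xorSum (λ v → (f zero == v) ∧ G v) xor xorSum (λ v → image (f ∘ suc) v ∧ G v)
    ≡⟨ xorSum-xor (λ v → (f zero == v) ∧ G v) (λ v → image (f ∘ suc) v ∧ G v) ⟨
  xorSum (λ v → ((f zero == v) ∧ G v) xor (image (f ∘ suc) v ∧ G v))
    ≡⟨ xorSum-cong (λ v → disjoint-xor (f zero == v) (image (f ∘ suc) v) (G v) (image-head f f-inj v)) ⟩
  xorSum (λ v → image f v ∧ G v) ∎
  where
  open ≡-Reasoning
  disjoint-xor : ∀ a b g → (a ≡ true → b ≡ false) → (a ∧ g) xor (b ∧ g) ≡ (a ∨ b) ∧ g
  disjoint-xor true  b g a⇒¬b rewrite a⇒¬b refl = BoolP.xor-identityʳ g
  disjoint-xor false b g a⇒¬b = refl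

weight-empty : ∀ k → weight {k} (λ _ → false) (λ _ → false) ≡ 1ᵐ
weight-empty zero    = refl
weight-empty (suc k) = trans (⊗-identityˡ _) (weight-empty k)

Ψ-empty : ∀ K m → Ψ K m (λ _ → false) (λ _ → false) ≡ 1𝔸
Ψ-empty K zero    = refl
Ψ-empty K (suc m) = trans (cong₂ _⊛_ (cong ⟦_⟧ (weight-empty K)) (Ψ-empty K m)) (⊛-identityˡ 1𝔸)

minor : ∀ K m j (rows cols : Fin j → Fin (suc (m ℕ.* K))) → Injective _≡_ _≡_ rows → Injective _≡_ _≡_ cols →
        det₂ j (λ r c → windmill (suc K) m (rows r) (cols c)) ≡ Φ K m (image rows) (image cols)
minor K m zero    rows cols _ _ = sym (cong (coeff false false) (Ψ-empty K m))
minor K m (suc j) rows cols rows-inj cols-inj = begin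
  xorSum (λ l → W r₀ (cols l) ∧ det₂ j (λ r c → W (rows (suc r)) (cols (punchIn l c))))
    ≡⟨ xorSum-cong (λ l → cong (W r₀ (cols l) ∧_)
         (trans (minor K m j (rows ∘ suc) (cols ∘ punchIn l)
                       (λ eq → FinP.suc-injective (rows-inj eq)) (λ eq → FinP.punchIn-injective l _ _ (cols-inj eq)))
                (Φ-cong K m (image-punchIn rows rows-inj zero) (image-punchIn cols cols-inj l)))) ⟩
  xorSum (λ l → W r₀ (cols l) ∧ Φ K m (image rows ∖ r₀) (image cols ∖ cols l))
    ≡⟨ xorSum-image cols cols-inj (λ v → W r₀ v ∧ Φ K m (image rows ∖ r₀) (image cols ∖ v)) ⟩
  xorSum (λ v → image cols v ∧ (W r₀ v ∧ Φ K m (image rows ∖ r₀) (image cols ∖ v)))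
    ≡⟨ Φ-row-expansion K m (image rows) (image cols) r₀ (cong (_∨ image (rows ∘ suc) r₀) (==-refl r₀)) ⟩
  Φ K m (image rows) (image cols) ∎
  where
  open ≡-Reasoning
  W  = windmill (suc K) m
  r₀ = rows zero

image-self : ∀ {j n} (f : Fin j → Fin n) i → image f (f i) ≡ true
image-self {suc j} f i = trans (any-punchIn i (λ l → f l == f i)) (cong (_∨ image (f ∘ punchIn i) (f i)) (==-refl (f i)))

-- Feasible sets of D(K_{K+1}^{(m)})

data Distinct {n} : List (Fin n) → Set where
  []  : Distinct []
  _∷_ : ∀ {x xs} → image (lookupL xs) x ≡ false → Distinct xs → Distinct (x ∷ xs)

lookupL-injective : ∀ {n} {xs : List (Fin n)} → Distinct xs → Injective _≡_ _≡_ (lookupL xs)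
lookupL-injective {xs = x ∷ xs} (x∉xs ∷ d) {zero}  {zero}  eq = refl
lookupL-injective {xs = x ∷ xs} (x∉xs ∷ d) {zero}  {suc j} eq =
  contradiction (trans (sym (image-self (lookupL xs) j)) (trans (cong (image (lookupL xs)) (sym eq)) x∉xs)) λ ()
lookupL-injective {xs = x ∷ xs} (x∉xs ∷ d) {suc i} {zero}  eq =
  contradiction (trans (sym (image-self (lookupL xs) i)) (trans (cong (image (lookupL xs)) eq) x∉xs)) λ ()
lookupL-injective {xs = x ∷ xs} (x∉xs ∷ d) {suc i} {suc j} eq = cong suc (lookupL-injective d eq)

image-lookupL-map-suc : ∀ {n} (ys : List (Fin n)) v →
                        image (lookupL (map suc ys)) (suc v) ≡ image (lookupL ys) v
image-lookupL-map-suc []       v = refl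
image-lookupL-map-suc (y ∷ ys) v = cong ((y == v) ∨_) (image-lookupL-map-suc ys v)

zero∉map-suc : ∀ {n} (ys : List (Fin n)) → image (lookupL (map suc ys)) zero ≡ false
zero∉map-suc []       = refl
zero∉map-suc (y ∷ ys) = zero∉map-suc ys

map-suc-distinct : ∀ {n} {ys : List (Fin n)} → Distinct ys → Distinct (map suc ys)
map-suc-distinct []                     = []
map-suc-distinct {ys = y ∷ ys} (y∉ys ∷ d) = trans (image-lookupL-map-suc ys y) y∉ys ∷ map-suc-distinct d

elems-distinct : ∀ {n} (S : Subset n) → Distinct (elems S)
elems-distinct []          = []
elems-distinct (true  ∷ S) = zero∉map-suc (elems S) ∷ map-suc-distinct (elems-distinct S)
elems-distinct (false ∷ S) = map-suc-distinct (elems-distinct S)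

image-elems : ∀ {n} (S : Subset n) → image (lookupL (elems S)) ≗ Vec.lookup S
image-elems (true  ∷ S) zero    = refl
image-elems (false ∷ S) zero    = zero∉map-suc (elems S)
image-elems (true  ∷ S) (suc v) = trans (image-lookupL-map-suc (elems S) v) (image-elems S v)
image-elems (false ∷ S) (suc v) = trans (image-lookupL-map-suc (elems S) v) (image-elems S v)

D-windmill≡Φ : ∀ K m S → D (windmill (suc K) m) S ≡ Φ K m (Vec.lookup S) (Vec.lookup S)
D-windmill≡Φ K m S = trans (minor K m _ (lookupL (elems S)) (lookupL (elems S)) inj inj)
                           (Φ-cong K m (image-elems S) (image-elems S))
  where inj = lookupL-injective (elems-distinct S)

none : ∀ {m} → Vector Bool m → Bool
none {zero}  q = true
none {suc m} q = not (head q) ∧ none (tail q)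

exactlyOne : ∀ {m} → Vector Bool m → Bool
exactlyOne {zero}  q = false
exactlyOne {suc m} q = if head q then none (tail q) else exactlyOne (tail q)

parities : ∀ K m → Vector Bool (m ℕ.* K) → Vector Bool m
parities K (suc m) f zero    = xorSum (take K f)
parities K (suc m) f (suc i) = parities K m (drop K f) i

weight-diagonal : ∀ {k} (b : Vector Bool k) → weight b b ≡ mono (xorSum b) false false
weight-diagonal {zero}  b = refl
weight-diagonal {suc k} b rewrite weight-diagonal (tail b) with head b
... | true  = refl
... | false = refl

Ψ-diagonal : ∀ K m (f : Vector Bool (m ℕ.* K)) →
             Ψ K m f f ≡ ⟨ none (parities K m f) , false , false , exactlyOne (parities K m f) ⟩
Ψ-diagonal K zero    f = refl
Ψ-diagonal K (suc m) f rewrite weight-diagonal (take K f) | Ψ-diagonal K m (drop K f) =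
  blade-step (xorSum (take K f)) (none (parities K m (drop K f))) (exactlyOne (parities K m (drop K f)))
  where
  blade-step : ∀ x E O → ⟦ mono x false false ⟧ ⊛ ⟨ E , false , false , O ⟩
                         ≡ ⟨ not x ∧ E , false , false , (if x then E else O) ⟩
  blade-step x E O = by-evaluation (λ (x , E , O) → ⟦ mono x false false ⟧ ⊛ ⟨ E , false , false , O ⟩)
                                   (λ (x , E , O) → ⟨ not x ∧ E , false , false , (if x then E else O) ⟩) (x , E , O)

admissible : ∀ {m} → Bool → Vector Bool m → Bool
admissible c q = if c then exactlyOne q else none q

feasible : ∀ K m → Vector Bool (suc (m ℕ.* K)) → Bool
feasible K m S = admissible (head S) (parities K m (tail S))

Φ-diagonal : ∀ K m (S : Vector Bool (suc (m ℕ.* K))) → Φ K m S S ≡ feasible K m S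
Φ-diagonal K m S rewrite Ψ-diagonal K m (tail S) with head S
... | true  = refl
... | false = refl

module Sizes where

  open import Data.Bool.Properties using (T?)
  open import Data.Fin.Subset using (∣_∣)
  import Data.List as List
  open import Data.List.Membership.Propositional using (_∈_)
  open import Data.List.Membership.Propositional.Properties using (∈-++⁺ˡ; ∈-++⁺ʳ; ∈-map⁺)
  open import Data.List.Relation.Unary.Any using (here; there)
  open import Data.Nat using (_+_; _*_; _∸_; _⊔_; _⊓_)
  import Data.Nat.Properties as ℕP
  open ℕP using (≤-refl; ≤-trans; ≤-reflexive; ≤-antisym; +-mono-≤; +-monoʳ-≤; +-assoc; +-comm; +-suc;
                 +-identityʳ; m≤n⇒m<n∨m≡n; n≤1+n; suc-injective; m+n≤o⇒m≤o∸n; m+n∸n≡m;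
                 ⊔-lub; ⊓-glb; m≤m⊔n; m≤n⊔m; m⊓n≤m; m⊓n≤n; module ≤-Reasoning)
  open import Algebra.Properties.CommutativeSemigroup ℕP.+-commutativeSemigroup using (interchange)
  open import Data.Product using (Σ)
  open import Data.Vec using (tabulate)
  open import Data.Vec.Properties using (lookup-zipWith; lookup∘tabulate)
  open import Data.Vec.Functional using (_++_) renaming (_∷_ to _∷ᶠ_)
  open import Data.Vec.Functional.Properties using (lookup-++ˡ; lookup-++ʳ)
  open import Defs using (SetSystem; allSubsets; maxSize; minSize; width; _✱_; _△_)

  𝟙[_] : Bool → ℕ
  𝟙[ true  ] = 1
  𝟙[ false ] = 0

  count : ∀ {n} → Vector Bool n → ℕ
  count {zero}  f = 0
  count {suc n} f = 𝟙[ head f ] + count (tail f)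

  distance : ∀ {n} → Vector Bool n → Vector Bool n → ℕ
  distance f g = count (λ i → f i xor g i)

  parity : ℕ → Bool
  parity zero    = false
  parity (suc n) = not (parity n)

  count-cong : ∀ {n} {f g : Vector Bool n} → f ≗ g → count f ≡ count g
  count-cong {zero}  f≗g = refl
  count-cong {suc n} f≗g = cong₂ _+_ (cong 𝟙[_] (f≗g zero)) (count-cong (f≗g ∘ suc))

  count-false : ∀ {n} → count {n} (λ _ → false) ≡ 0
  count-false {zero}  = refl
  count-false {suc n} = count-false {n}

  count-true : ∀ {n} → count {n} (λ _ → true) ≡ n
  count-true {zero}  = refl
  count-true {suc n} = cong suc (count-true {n})

  𝟙-≤ : ∀ b → 𝟙[ b ] ≤ 1
  𝟙-≤ true  = ≤-refl
  𝟙-≤ false = z≤n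

  count-≤ : ∀ {n} (f : Vector Bool n) → count f ≤ n
  count-≤ {zero}  f = z≤n
  count-≤ {suc n} f = +-mono-≤ (𝟙-≤ (head f)) (count-≤ (tail f))

  count-++ : ∀ k {n} (f : Vector Bool (k + n)) → count f ≡ count (take k f) + count (drop k f)
  count-++ zero    f = refl
  count-++ (suc k) f = trans (cong (𝟙[ head f ] +_) (count-++ k (tail f))) (sym (+-assoc 𝟙[ head f ] _ _))

  count-not : ∀ {n} (f : Vector Bool n) → count (not ∘ f) + count f ≡ n
  count-not {zero}  f = refl
  count-not {suc n} f with head f
  ... | true  = trans (+-suc _ _) (cong suc (count-not (tail f)))
  ... | false = cong suc (count-not (tail f))

  parity-count : ∀ {n} (f : Vector Bool n) → parity (count f) ≡ xorSum f
  parity-count {zero}  f = refl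
  parity-count {suc n} f with head f
  ... | true  = cong not (parity-count (tail f))
  ... | false = parity-count (tail f)

  xorSum-not : ∀ {n} (f : Vector Bool n) → xorSum (not ∘ f) ≡ xorSum f xor parity n
  xorSum-not {zero}  f = refl
  xorSum-not {suc n} f = trans (cong (not (head f) xor_) (xorSum-not (tail f)))
    (by-evaluation (λ (x , y , z) → not x xor (y xor z)) (λ (x , y , z) → (x xor y) xor not z)
                   (head f , xorSum (tail f) , parity n))

  𝟙-parity-≤ : ∀ x → 𝟙[ parity x ] ≤ x
  𝟙-parity-≤ zero    = z≤n
  𝟙-parity-≤ (suc x) = ≤-trans (𝟙-≤ _) (s≤s z≤n)

  parity-gap : ∀ x K → x ≤ K → x + 𝟙[ parity x xor parity K ] ≤ K
  parity-gap x K x≤K with m≤n⇒m<n∨m≡n x≤K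
  ... | inj₁ x<K  = ≤-trans (+-monoʳ-≤ x (𝟙-≤ _)) (≤-trans (≤-reflexive (+-comm x 1)) x<K)
  ... | inj₂ refl = ≤-reflexive (trans (cong (λ b → x + 𝟙[ b ]) (BoolP.xor-same (parity x))) (+-identityʳ x))

  module _ {K : ℕ} (f a : Vector Bool K) where

    parity-distance : parity (distance f a) ≡ xorSum f xor xorSum a
    parity-distance = trans (parity-count (λ i → f i xor a i)) (xorSum-xor f a)

    blade-lower : 𝟙[ xorSum f xor xorSum a ] ≤ distance f a
    blade-lower = subst (λ b → 𝟙[ b ] ≤ distance f a) parity-distance (𝟙-parity-≤ (distance f a))

    blade-upper : distance f a + 𝟙[ xorSum f xor (xorSum a xor parity K) ] ≤ K
    blade-upper = subst (λ b → distance f a + 𝟙[ b ] ≤ K)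
                        (trans (cong (_xor parity K) parity-distance) (BoolP.xor-assoc (xorSum f) _ _))
                        (parity-gap (distance f a) K (count-≤ (λ i → f i xor a i)))

  count-xor-self : ∀ {n} (f : Vector Bool n) → count (λ i → f i xor f i) ≡ 0
  count-xor-self {n} f = trans (count-cong (λ i → BoolP.xor-same (f i))) (count-false {n})

  count-not-xor-self : ∀ {n} (f : Vector Bool n) → count (λ i → not (f i) xor f i) ≡ n
  count-not-xor-self {n} f = trans (count-cong (λ i → BoolP.xor-inverseˡ (f i))) (count-true {n})

  -- Flipping the first vertex of a or of its complement realises any parity p
  -- with the least, respectively the greatest, possible distance to a.
  blade-lower-witness : ∀ {k} p (a : Vector Bool (suc k)) →
    Σ (Vector Bool (suc k)) λ f → xorSum f ≡ p × distance f a ≡ 𝟙[ p xor xorSum a ]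
  blade-lower-witness p a = f , parity-f , distance-f
    where
    b = p xor xorSum a
    f : Vector Bool _
    f zero    = a zero xor b
    f (suc i) = a (suc i)
    parity-f : xorSum f ≡ p
    parity-f = by-evaluation (λ (a₀ , p , X) → (a₀ xor (p xor (a₀ xor X))) xor X) (λ (_ , p , _) → p)
                             (a zero , p , xorSum (tail a))
    distance-f : distance f a ≡ 𝟙[ b ]
    distance-f = trans (cong₂ _+_ (cong 𝟙[_] (by-evaluation (λ (a₀ , b) → (a₀ xor b) xor a₀) (λ (_ , b) → b) (a zero , b)))
                                  (count-xor-self (tail a)))
                       (+-identityʳ 𝟙[ b ])

  blade-upper-witness : ∀ {k} p (a : Vector Bool (suc k)) →
    Σ (Vector Bool (suc k)) λ f → xorSum f ≡ p × distance f a + 𝟙[ p xor (xorSum a xor parity (suc k)) ] ≡ suc k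
  blade-upper-witness {k} p a = f , parity-f , distance-f
    where
    b = p xor (xorSum a xor parity (suc k))
    f : Vector Bool _
    f zero    = not (a zero) xor b
    f (suc i) = not (a (suc i))
    parity-f : xorSum f ≡ p
    parity-f = trans (cong ((not (a zero) xor b) xor_) (xorSum-not (tail a)))
      (by-evaluation (λ (a₀ , p , X , P) → (not a₀ xor (p xor ((a₀ xor X) xor not P))) xor (X xor P)) (λ (_ , p , _) → p)
                     (a zero , p , xorSum (tail a) , parity k))
    distance-f : 𝟙[ (not (a zero) xor b) xor a zero ] + count (λ i → not (a (suc i)) xor a (suc i)) + 𝟙[ b ] ≡ suc k
    distance-f rewrite count-not-xor-self (tail a)
                     | by-evaluation (λ (a₀ , b) → (not a₀ xor b) xor a₀) (λ (_ , b) → not b) (a zero , b)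
      with b
    ... | true  = +-comm k 1
    ... | false = cong suc (+-identityʳ k)

  parities-cong : ∀ K m {F G : Vector Bool (m * K)} → F ≗ G → parities K m F ≗ parities K m G
  parities-cong K (suc m) F≗G zero    = xorSum-cong (F≗G ∘ (_↑ˡ m * K))
  parities-cong K (suc m) F≗G (suc i) = parities-cong K m (F≗G ∘ (K ↑ʳ_)) i

  distance-++ : ∀ {k n} (f : Vector Bool k) (g : Vector Bool n) A →
                distance (f ++ g) A ≡ distance f (take k A) + distance g (drop k A)
  distance-++ {k} f g A = trans (count-++ k _)
    (cong₂ _+_ (count-cong (λ i → cong (_xor A (i ↑ˡ _)) (lookup-++ˡ f g i)))
               (count-cong (λ i → cong (_xor A (k ↑ʳ i)) (lookup-++ʳ f g i))))

  blades-lower : ∀ K m (F A : Vector Bool (m * K)) → distance (parities K m F) (parities K m A) ≤ distance F A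
  blades-lower K zero    F A = z≤n
  blades-lower K (suc m) F A = subst (distance (parities K (suc m) F) (parities K (suc m) A) ≤_)
                                     (sym (count-++ K (λ v → F v xor A v)))
    (+-mono-≤ (blade-lower (take K F) (take K A)) (blades-lower K m (drop K F) (drop K A)))

  blades-upper : ∀ K m (F A : Vector Bool (m * K)) →
                 distance F A + distance (parities K m F) (λ i → parities K m A i xor parity K) ≤ m * K
  blades-upper K zero    F A = z≤n
  blades-upper K (suc m) F A = begin
    distance F A + (𝟙[ p xor (α xor parity K) ] + d)
      ≡⟨ cong (_+ (𝟙[ p xor (α xor parity K) ] + d)) (count-++ K (λ v → F v xor A v)) ⟩
    (distance (take K F) (take K A) + distance (drop K F) (drop K A)) + (𝟙[ p xor (α xor parity K) ] + d)
      ≡⟨ interchange (distance (take K F) (take K A)) (distance (drop K F) (drop K A)) 𝟙[ p xor (α xor parity K) ] d ⟩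
    (distance (take K F) (take K A) + 𝟙[ p xor (α xor parity K) ]) + (distance (drop K F) (drop K A) + d)
      ≤⟨ +-mono-≤ (blade-upper (take K F) (take K A)) (blades-upper K m (drop K F) (drop K A)) ⟩
    K + m * K ∎
    where
    open ≤-Reasoning
    p = xorSum (take K F)
    α = xorSum (take K A)
    d =    distance (parities K m (drop K F)) (λ i → parities K m (drop K A) i xor parity K)

  blades-lower-witness : ∀ k m (q : Vector Bool m) (A : Vector Bool (m * suc k)) →
    Σ (Vector Bool (m * suc k)) λ F → parities (suc k) m F ≗ q × distance F A ≡ distance q (parities (suc k) m A)
  blades-lower-witness k zero    q A = (λ ()) , (λ ()) , refl
  blades-lower-witness k (suc m) q A
    with blade-lower-witness (q zero) (take (suc k) A) | blades-lower-witness k m (tail q) (drop (suc k) A)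
  ... | f , par-f , dist-f | F , par-F , dist-F = f ++ F , par , trans (distance-++ f F A) (cong₂ _+_ dist-f dist-F)
    where
    par : parities (suc k) (suc m) (f ++ F) ≗ q
    par zero    = trans (xorSum-cong (lookup-++ˡ f F)) par-f
    par (suc i) = trans (parities-cong (suc k) m (lookup-++ʳ f F) i) (par-F i)

  blades-upper-witness : ∀ k m (q : Vector Bool m) (A : Vector Bool (m * suc k)) →
    Σ (Vector Bool (m * suc k)) λ F → parities (suc k) m F ≗ q ×
      distance F A + distance q (λ i → parities (suc k) m A i xor parity (suc k)) ≡ m * suc k
  blades-upper-witness k zero    q A = (λ ()) , (λ ()) , refl
  blades-upper-witness k (suc m) q A
    with blade-upper-witness (q zero) (take (suc k) A) | blades-upper-witness k m (tail q) (drop (suc k) A)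
  ... | f , par-f , dist-f | F , par-F , dist-F = f ++ F , par , size
    where
    α = xorSum (take (suc k) A)
    d = distance (tail q) (λ i → parities (suc k) m (drop (suc k) A) i xor parity (suc k))
    size : distance (f ++ F) A + distance q (λ i → parities (suc k) (suc m) A i xor parity (suc k)) ≡ suc m * suc k
    size = begin
        distance (f ++ F) A + (𝟙[ q zero xor (α xor parity (suc k)) ] + d)
        ≡⟨ cong (_+ (𝟙[ q zero xor (α xor parity (suc k)) ] + d)) (distance-++ f F A) ⟩
      (distance f (take (suc k) A) + distance F (drop (suc k) A)) + (𝟙[ q zero xor (α xor parity (suc k)) ] + d)
        ≡⟨ interchange (distance f (take (suc k) A)) (distance F (drop (suc k) A)) 𝟙[ q zero xor (α xor parity (suc k)) ] d ⟩
      (distance f (take (suc k) A) + 𝟙[ q zero xor (α xor parity (suc k)) ]) + (distance F (drop (suc k) A) + d)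
        ≡⟨ cong₂ _+_ dist-f dist-F ⟩
      suc k + m * suc k ∎
      where open ≡-Reasoning
    par : parities (suc k) (suc m) (f ++ F) ≗ q
    par zero    = trans (xorSum-cong (lookup-++ˡ f F)) par-f
    par (suc i) = trans (parities-cong (suc k) m (lookup-++ʳ f F) i) (par-F i)

  none-cong : ∀ {m} {q q′ : Vector Bool m} → q ≗ q′ → none q ≡ none q′
  none-cong {zero}  q≗q′ = refl
  none-cong {suc m} q≗q′ = cong₂ (λ x y → not x ∧ y) (q≗q′ zero) (none-cong (q≗q′ ∘ suc))

  exactlyOne-cong : ∀ {m} {q q′ : Vector Bool m} → q ≗ q′ → exactlyOne q ≡ exactlyOne q′
  exactlyOne-cong {zero}  q≗q′ = refl
  exactlyOne-cong {suc m} q≗q′ = cong₂ (λ x (E , O) → if x then E else O) (q≗q′ zero)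
                                       (cong₂ _,_ (none-cong (q≗q′ ∘ suc)) (exactlyOne-cong (q≗q′ ∘ suc)))

  admissible-cong : ∀ {m} c {q q′ : Vector Bool m} → q ≗ q′ → admissible c q ≡ admissible c q′
  admissible-cong true  = exactlyOne-cong
  admissible-cong false = none-cong

  none-false : ∀ {m} → none {m} (λ _ → false) ≡ true
  none-false {zero}  = refl
  none-false {suc m} = none-false {m}

  -- The distance from a vector with t ones to the nearest vector with exactly one.
  oneHotDistance : ℕ → ℕ
  oneHotDistance zero    = 1
  oneHotDistance (suc t) = t

  oneHotDistance-≤ : ∀ t → oneHotDistance t ≤ suc t
  oneHotDistance-≤ zero    = s≤s z≤n
  oneHotDistance-≤ (suc t) = ≤-trans (n≤1+n t) (n≤1+n (suc t))

  ≤-oneHotDistance : ∀ t → t ≤ suc (oneHotDistance t)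
  ≤-oneHotDistance zero    = z≤n
  ≤-oneHotDistance (suc t) = ≤-refl

  none-distance : ∀ {m} (q γ : Vector Bool m) → none q ≡ true → distance q γ ≡ count γ
  none-distance {zero}  q γ none-q = refl
  none-distance {suc m} q γ none-q with q zero
  ... | false = cong (𝟙[ γ zero ] +_) (none-distance (tail q) (tail γ) none-q)

  exactlyOne-distance : ∀ {m} (q γ : Vector Bool m) → exactlyOne q ≡ true →
                        oneHotDistance (count γ) ≤ distance q γ
  exactlyOne-distance {suc m} q γ one-q with q zero | γ zero
  ... | true  | true  = ≤-reflexive (sym (none-distance (tail q) (tail γ) one-q))
  ... | true  | false = subst (oneHotDistance (count (tail γ)) ≤_) (cong suc (sym (none-distance (tail q) (tail γ) one-q)))
                              (oneHotDistance-≤ (count (tail γ)))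
  ... | false | true  = ≤-trans (≤-oneHotDistance (count (tail γ))) (s≤s (exactlyOne-distance (tail q) (tail γ) one-q))
  ... | false | false = exactlyOne-distance (tail q) (tail γ) one-q

  oneHot-witness : ∀ {m} (γ : Vector Bool m) → 0 < count γ →
                   Σ (Vector Bool m) λ q → exactlyOne q ≡ true × suc (distance q γ) ≡ count γ
  oneHot-witness {suc m} γ pos with γ zero
  ... | true  = (true ∷ᶠ λ _ → false) , none-false {m} , refl
  ... | false with oneHot-witness (tail γ) pos
  ...   | q , one-q , dist-q = (false ∷ᶠ q) , one-q , dist-q

  -- The least value of 𝟙[ c ≠ a ] + distance q γ over admissible patterns (c , q).
  patternCost : Bool → ℕ → ℕ
  patternCost a t = if a then oneHotDistance t else t

  pattern-lower : ∀ {m} a c (q γ : Vector Bool m) → admissible c q ≡ true →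
                  patternCost a (count γ) ≤ 𝟙[ c xor a ] + distance q γ
  pattern-lower false false q γ adm = ≤-reflexive (sym (none-distance q γ adm))
  pattern-lower true  false q γ adm = subst (oneHotDistance (count γ) ≤_) (cong suc (sym (none-distance q γ adm)))
                                            (oneHotDistance-≤ (count γ))
  pattern-lower false true  q γ adm = ≤-trans (≤-oneHotDistance (count γ)) (s≤s (exactlyOne-distance q γ adm))
  pattern-lower true  true  q γ adm = exactlyOne-distance q γ adm

  pattern-witness : ∀ {m} a (γ : Vector Bool m) →
    Σ (Bool × Vector Bool m) λ (c , q) → admissible c q ≡ true × 𝟙[ c xor a ] + distance q γ ≡ patternCost a (count γ)
  pattern-witness {m} false γ = (false , λ _ → false) , none-false {m} , refl
  pattern-witness {m} true  γ with count γ in count-γ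
  ... | zero  = (false , λ _ → false) , none-false {m} , cong suc count-γ
  ... | suc t with oneHot-witness γ (subst (0 <_) (sym count-γ) (s≤s z≤n))
  ...   | q , one-q , dist-q = (true , q) , one-q , suc-injective (trans dist-q count-γ)

  𝟙-xor-not : ∀ c a → 𝟙[ c xor a ] + 𝟙[ c xor not a ] ≡ 1
  𝟙-xor-not true  true  = refl
  𝟙-xor-not true  false = refl
  𝟙-xor-not false true  = refl
  𝟙-xor-not false false = refl

  module _ (K m : ℕ) where

    size-lower : ∀ F A → feasible K m F ≡ true →
                 patternCost (head A) (count (parities K m (tail A))) ≤ distance F A
    size-lower F A feas =
      ≤-trans (pattern-lower (head A) (head F) (parities K m (tail F)) (parities K m (tail A)) feas)
              (+-monoʳ-≤ 𝟙[ head F xor head A ] (blades-lower K m (tail F) (tail A)))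

    -- Maximising |F △ A| means minimising |F △ (V ∖ A)|, and the blade parities
    -- of V ∖ A are those of A shifted by the parity of K.
    size-upper : ∀ F A → feasible K m F ≡ true →
                 distance F A + patternCost (not (head A)) (count (λ i → parities K m (tail A) i xor parity K))
                 ≤ suc (m * K)
    size-upper F A feas = begin
      (𝟙[ c xor a ] + X) + cost
        ≤⟨ +-monoʳ-≤ (𝟙[ c xor a ] + X) (pattern-lower (not a) c q β feas) ⟩
      (𝟙[ c xor a ] + X) + (𝟙[ c xor not a ] + distance q β)
        ≡⟨ interchange 𝟙[ c xor a ] X 𝟙[ c xor not a ] (distance q β) ⟩
      (𝟙[ c xor a ] + 𝟙[ c xor not a ]) + (X + distance q β)
        ≡⟨ cong (_+ (X + distance q β)) (𝟙-xor-not c a) ⟩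
      suc (X + distance q β)
        ≤⟨ s≤s (blades-upper K m (tail F) (tail A)) ⟩
      suc (m * K) ∎
      where
      open ≤-Reasoning
      a = head A
      c = head F
      q = parities K m (tail F)
      β = λ i → parities K m (tail A) i xor parity K
      X = distance (tail F) (tail A)
      cost = patternCost (not a) (count β)

  module _ (k m : ℕ) where

    size-lower-witness : ∀ A → Σ (Vector Bool (suc (m * suc k))) λ F →
      feasible (suc k) m F ≡ true × distance F A ≡ patternCost (head A) (count (parities (suc k) m (tail A)))
    size-lower-witness A with pattern-witness (head A) (parities (suc k) m (tail A))
    ... | (c , q) , adm , dist with blades-lower-witness k m q (tail A)
    ...   | F , par-F , dist-F = (c ∷ᶠ F) , trans (admissible-cong c par-F) adm
                                          , trans (cong (𝟙[ c xor head A ] +_) dist-F) dist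

    size-upper-witness : ∀ A → Σ (Vector Bool (suc (m * suc k))) λ F →
      feasible (suc k) m F ≡ true ×
      distance F A + patternCost (not (head A)) (count (λ i → parities (suc k) m (tail A) i xor parity (suc k)))
        ≡ suc (m * suc k)
    size-upper-witness A with pattern-witness (not (head A)) (λ i → parities (suc k) m (tail A) i xor parity (suc k))
    ... | (c , q) , adm , dist with blades-upper-witness k m q (tail A)
    ...   | F , par-F , dist-F = (c ∷ᶠ F) , trans (admissible-cong c par-F) adm , (begin
      (𝟙[ c xor head A ] + distance F (tail A)) + patternCost (not (head A)) (count β)
        ≡⟨ cong ((𝟙[ c xor head A ] + distance F (tail A)) +_) dist ⟨
      (𝟙[ c xor head A ] + distance F (tail A)) + (𝟙[ c xor not (head A) ] + distance q β)
        ≡⟨ interchange 𝟙[ c xor head A ] (distance F (tail A)) 𝟙[ c xor not (head A) ] (distance q β) ⟩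
      (𝟙[ c xor head A ] + 𝟙[ c xor not (head A) ]) + (distance F (tail A) + distance q β)
        ≡⟨ cong₂ _+_ (𝟙-xor-not c (head A)) dist-F ⟩
      suc (m * suc k) ∎)
      where
      open ≡-Reasoning
      β = λ i → parities (suc k) m (tail A) i xor parity (suc k)

  feasible-cong : ∀ K m {F G : Vector Bool (suc (m * K))} → F ≗ G → feasible K m F ≡ feasible K m G
  feasible-cong K m {F} {G} F≗G = trans (cong (λ c → admissible c (parities K m (tail F))) (F≗G zero))
                                        (admissible-cong (G zero) (parities-cong K m (F≗G ∘ suc)))

  ∈-allSubsets : ∀ N (X : Subset N) → X ∈ allSubsets N
  ∈-allSubsets zero    []          = here refl
  ∈-allSubsets (suc N) (true  ∷ X) = ∈-++⁺ˡ (∈-map⁺ (true ∷_) (∈-allSubsets N X))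
  ∈-allSubsets (suc N) (false ∷ X) =
    ∈-++⁺ʳ (List.map (true ∷_) (allSubsets N)) (∈-map⁺ (false ∷_) (∈-allSubsets N X))

  ∣∣≡count : ∀ {N} (X : Subset N) → ∣ X ∣ ≡ count (Vec.lookup X)
  ∣∣≡count []          = refl
  ∣∣≡count (true  ∷ X) = cong suc (∣∣≡count X)
  ∣∣≡count (false ∷ X) = ∣∣≡count X

  module _ {N : ℕ} (𝓕 : SetSystem N) where

    private
      largest smallest : List (Subset N) → ℕ
      largest  L = List.foldr (λ X r → ∣ X ∣ ⊔ r) 0 (List.filter (λ X → T? (𝓕 X)) L)
      smallest L = List.foldr (λ X r → ∣ X ∣ ⊓ r) N (List.filter (λ X → T? (𝓕 X)) L)

      largest-≤ : ∀ v L → (∀ X → 𝓕 X ≡ true → ∣ X ∣ ≤ v) → largest L ≤ v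
      largest-≤ v []      bound = z≤n
      largest-≤ v (X ∷ L) bound with 𝓕 X in 𝓕X
      ... | true  = ⊔-lub (bound X 𝓕X) (largest-≤ v L bound)
      ... | false = largest-≤ v L bound

      ≤-largest : ∀ X₀ L → X₀ ∈ L → 𝓕 X₀ ≡ true → ∣ X₀ ∣ ≤ largest L
      ≤-largest X₀ (X ∷ L) (here refl) 𝓕X₀ rewrite 𝓕X₀ = m≤m⊔n _ _
      ≤-largest X₀ (X ∷ L) (there X₀∈L) 𝓕X₀ with 𝓕 X
      ... | true  = ≤-trans (≤-largest X₀ L X₀∈L 𝓕X₀) (m≤n⊔m _ _)
      ... | false = ≤-largest X₀ L X₀∈L 𝓕X₀

      ≤-smallest : ∀ v L → v ≤ N → (∀ X → 𝓕 X ≡ true → v ≤ ∣ X ∣) → v ≤ smallest L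
      ≤-smallest v []      v≤N bound = v≤N
      ≤-smallest v (X ∷ L) v≤N bound with 𝓕 X in 𝓕X
      ... | true  = ⊓-glb (bound X 𝓕X) (≤-smallest v L v≤N bound)
      ... | false = ≤-smallest v L v≤N bound

      smallest-≤ : ∀ X₀ L → X₀ ∈ L → 𝓕 X₀ ≡ true → smallest L ≤ ∣ X₀ ∣
      smallest-≤ X₀ (X ∷ L) (here refl) 𝓕X₀ rewrite 𝓕X₀ = m⊓n≤m _ _
      smallest-≤ X₀ (X ∷ L) (there X₀∈L) 𝓕X₀ with 𝓕 X
      ... | true  = ≤-trans (m⊓n≤n _ _) (smallest-≤ X₀ L X₀∈L 𝓕X₀)
      ... | false = smallest-≤ X₀ L X₀∈L 𝓕X₀

    maxSize-≡ : ∀ v → (∀ X → 𝓕 X ≡ true → ∣ X ∣ ≤ v) →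
                ∀ X → 𝓕 X ≡ true → ∣ X ∣ ≡ v → maxSize 𝓕 ≡ v
    maxSize-≡ v bound X 𝓕X ∣X∣≡v = ≤-antisym (largest-≤ v (allSubsets N) bound)
      (subst (_≤ largest (allSubsets N)) ∣X∣≡v (≤-largest X (allSubsets N) (∈-allSubsets N X) 𝓕X))

    minSize-≡ : ∀ v → (∀ X → 𝓕 X ≡ true → v ≤ ∣ X ∣) →
                ∀ X → 𝓕 X ≡ true → ∣ X ∣ ≡ v → minSize 𝓕 ≡ v
    minSize-≡ v bound X 𝓕X ∣X∣≡v = ≤-antisym
      (subst (smallest (allSubsets N) ≤_) ∣X∣≡v (smallest-≤ X (allSubsets N) (∈-allSubsets N X) 𝓕X))
      (≤-smallest v (allSubsets N) (subst (_≤ N) (trans (sym (∣∣≡count X)) ∣X∣≡v) (count-≤ (Vec.lookup X))) bound)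

  windmillWidth : ∀ k m → Bool → Vector Bool m → ℕ
  windmillWidth k m a α =
    (suc (m * suc k) ∸ patternCost (not a) (count (λ i → α i xor parity (suc k)))) ∸ patternCost a (count α)

  module _ (k m : ℕ) (A : Subset (suc (m * suc k))) where

    private
      𝓓 = D (windmill (suc (suc k)) m) ✱ A
      a = Vec.lookup A zero
      α = parities (suc k) m (tail (Vec.lookup A))
      β = λ i → α i xor parity (suc k)

      xor-cancel : ∀ x y → (x xor y) xor y ≡ x
      xor-cancel x y = by-evaluation (λ (x , y) → (x xor y) xor y) (λ (x , _) → x) (x , y)

      twist : Subset (suc (m * suc k)) → Vector Bool (suc (m * suc k))
      twist X v = Vec.lookup X v xor Vec.lookup A v

      untwist : Vector Bool (suc (m * suc k)) → Subset (suc (m * suc k))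
      untwist F = tabulate (λ v → F v xor Vec.lookup A v)

      twist-untwist : ∀ F → twist (untwist F) ≗ F
      twist-untwist F v = trans (cong (_xor Vec.lookup A v) (lookup∘tabulate (λ v → F v xor Vec.lookup A v) v))
                                (xor-cancel (F v) (Vec.lookup A v))

      𝓓≡feasible : ∀ X → 𝓓 X ≡ feasible (suc k) m (twist X)
      𝓓≡feasible X = trans (D-windmill≡Φ (suc k) m (X △ A))
                           (trans (Φ-cong (suc k) m lookup-△ lookup-△) (Φ-diagonal (suc k) m (twist X)))
        where lookup-△ = λ v → lookup-zipWith _xor_ v X A

      ∣∣≡distance : ∀ X → ∣ X ∣ ≡ distance (twist X) (Vec.lookup A)
      ∣∣≡distance X = trans (∣∣≡count X) (count-cong λ v → sym (xor-cancel (Vec.lookup X v) (Vec.lookup A v)))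

      ∣untwist∣ : ∀ F → ∣ untwist F ∣ ≡ distance F (Vec.lookup A)
      ∣untwist∣ F = trans (∣∣≡distance (untwist F)) (count-cong λ v → cong (_xor Vec.lookup A v) (twist-untwist F v))

      sub-≡ : ∀ {x y z} → x + y ≡ z → x ≡ z ∸ y
      sub-≡ {x} {y} refl = sym (m+n∸n≡m x y)

    maxSize-twisted : maxSize 𝓓 ≡ suc (m * suc k) ∸ patternCost (not a) (count β)
    maxSize-twisted with size-upper-witness k m (Vec.lookup A)
    ... | F , feas , size = maxSize-≡ 𝓓 _ bound (untwist F)
      (trans (𝓓≡feasible (untwist F)) (trans (feasible-cong (suc k) m (twist-untwist F)) feas))
      (trans (∣untwist∣ F) (sub-≡ size))
      where
      bound : ∀ X → 𝓓 X ≡ true → ∣ X ∣ ≤ suc (m * suc k) ∸ patternCost (not a) (count β)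
      bound X 𝓓X = subst (_≤ _) (sym (∣∣≡distance X))
        (m+n≤o⇒m≤o∸n _ (size-upper (suc k) m (twist X) (Vec.lookup A) (trans (sym (𝓓≡feasible X)) 𝓓X)))

    minSize-twisted : minSize 𝓓 ≡ patternCost a (count α)
    minSize-twisted with size-lower-witness k m (Vec.lookup A)
    ... | F , feas , size = minSize-≡ 𝓓 _ bound (untwist F)
      (trans (𝓓≡feasible (untwist F)) (trans (feasible-cong (suc k) m (twist-untwist F)) feas))
      (trans (∣untwist∣ F) size)
      where
      bound : ∀ X → 𝓓 X ≡ true → patternCost a (count α) ≤ ∣ X ∣
      bound X 𝓓X = subst (_ ≤_) (sym (∣∣≡distance X))
        (size-lower (suc k) m (twist X) (Vec.lookup A) (trans (sym (𝓓≡feasible X)) 𝓓X))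

    width-twisted : width 𝓓 ≡ windmillWidth k m a α
    width-twisted = cong₂ _∸_ maxSize-twisted minSize-twisted

-- Sums over subsets

module Summation where

  open import Data.Fin using (splitAt)
  open import Data.Integer using (ℤ; +_; _+_; _-_; _*_; _^_)
  import Data.Integer.Properties as ℤ
  open import Data.Integer.Tactic.RingSolver using (solve-∀)
  import Data.List as List
  open import Data.Nat using (_∸_)
  open import Data.Nat.Properties using (≤-trans; n≤1+n; +-comm; +-∸-assoc; ∸-+-assoc; *-suc; m+n∸m≡n; m+[n∸m]≡n)
  import Data.Nat.Tactic.RingSolver as ℕ-Solver
  open import Data.Vec using (tabulate)
  open import Data.Vec.Properties using (lookup∘tabulate)
  open import Data.Vec.Functional using (_++_) renaming (_∷_ to _∷ᶠ_)
  open import Data.Vec.Functional.Properties using (lookup-++ˡ; lookup-++ʳ)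
  open import Defs using (T-graph; allSubsets; width; _✱_)
  open Sizes using (parity; count; count-cong; count-not; count-≤; parities-cong;
                    oneHotDistance; patternCost; windmillWidth; width-twisted)

  ∑ᶻ : ∀ n → (Vector Bool n → ℤ) → ℤ
  ∑ᶻ zero    G = G (λ ())
  ∑ᶻ (suc n) G = ∑ᶻ n (λ f → G (true ∷ᶠ f)) + ∑ᶻ n (λ f → G (false ∷ᶠ f))

  Extensional : ∀ {n} → (Vector Bool n → ℤ) → Set
  Extensional G = ∀ {f g} → f ≗ g → G f ≡ G g

  ∷-extensional : ∀ {n} {G : Vector Bool (suc n) → ℤ} → Extensional G → ∀ b → Extensional (λ f → G (b ∷ᶠ f))
  ∷-extensional G-ext b f≗g = G-ext λ { zero → refl ; (suc i) → f≗g i }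

  ∑ᶻ-cong : ∀ n {G G′ : Vector Bool n → ℤ} → (∀ f → G f ≡ G′ f) → ∑ᶻ n G ≡ ∑ᶻ n G′
  ∑ᶻ-cong zero    G≡G′ = G≡G′ _
  ∑ᶻ-cong (suc n) G≡G′ = cong₂ _+_ (∑ᶻ-cong n (G≡G′ ∘ (true ∷ᶠ_))) (∑ᶻ-cong n (G≡G′ ∘ (false ∷ᶠ_)))

  ∑ᶻ-*ˡ : ∀ n c (G : Vector Bool n → ℤ) → ∑ᶻ n (λ f → c * G f) ≡ c * ∑ᶻ n G
  ∑ᶻ-*ˡ zero    c G = refl
  ∑ᶻ-*ˡ (suc n) c G = trans (cong₂ _+_ (∑ᶻ-*ˡ n c _) (∑ᶻ-*ˡ n c _)) (sym (ℤ.*-distribˡ-+ c _ _))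

  ∑ᶻ-const : ∀ n c → ∑ᶻ n (λ _ → c) ≡ (+ 2) ^ n * c
  ∑ᶻ-const zero    c = sym (ℤ.*-identityˡ c)
  ∑ᶻ-const (suc n) c = trans (cong₂ _+_ (∑ᶻ-const n c) (∑ᶻ-const n c)) (double ((+ 2) ^ n) c)
    where double : ∀ P c → P * c + P * c ≡ + 2 * P * c
          double = solve-∀

  ∷-++ : ∀ {a b} x (f : Vector Bool a) (g : Vector Bool b) → (x ∷ᶠ f) ++ g ≗ x ∷ᶠ (f ++ g)
  ∷-++ {a} x f g zero    = refl
  ∷-++ {a} x f g (suc v) with splitAt a v
  ... | inj₁ _ = refl
  ... | inj₂ _ = refl

  ∑ᶻ-++ : ∀ a b (H : Vector Bool (a ℕ.+ b) → ℤ) → Extensional H →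
          ∑ᶻ (a ℕ.+ b) H ≡ ∑ᶻ a (λ f → ∑ᶻ b (λ g → H (f ++ g)))
  ∑ᶻ-++ zero    b H H-ext = refl
  ∑ᶻ-++ (suc a) b H H-ext = cong₂ _+_ (split true) (split false)
    where
    split : ∀ x → ∑ᶻ (a ℕ.+ b) (λ f → H (x ∷ᶠ f)) ≡ ∑ᶻ a (λ f → ∑ᶻ b (λ g → H ((x ∷ᶠ f) ++ g)))
    split x = trans (∑ᶻ-++ a b (λ f → H (x ∷ᶠ f)) (∷-extensional H-ext x))
                    (∑ᶻ-cong a λ f → ∑ᶻ-cong b λ g → H-ext (λ v → sym (∷-++ x f g v)))

  ∑ᶻ-xorSum : ∀ k (F : Bool → ℤ) → ∑ᶻ (suc k) (λ f → F (xorSum f)) ≡ (+ 2) ^ k * (F true + F false)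
  ∑ᶻ-xorSum zero    F = sym (ℤ.*-identityˡ _)
  ∑ᶻ-xorSum (suc k) F = trans (cong₂ _+_ (∑ᶻ-xorSum k (F ∘ not)) (∑ᶻ-xorSum k F)) (double ((+ 2) ^ k) (F true) (F false))
    where double : ∀ P a b → P * (b + a) + P * (a + b) ≡ + 2 * P * (a + b)
          double = solve-∀

  ∑ᶻ-not : ∀ m (H : Vector Bool m → ℤ) → Extensional H → ∑ᶻ m (λ α → H (not ∘ α)) ≡ ∑ᶻ m H
  ∑ᶻ-not zero    H H-ext = H-ext λ ()
  ∑ᶻ-not (suc m) H H-ext = trans (cong₂ _+_ (flip false) (flip true))
                                 (ℤ.+-comm (∑ᶻ m (λ α → H (false ∷ᶠ α))) (∑ᶻ m (λ α → H (true ∷ᶠ α))))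
    where
    flip : ∀ x → ∑ᶻ m (λ α → H (not ∘ (not x ∷ᶠ α))) ≡ ∑ᶻ m (λ α → H (x ∷ᶠ α))
    flip x = trans (∑ᶻ-cong m λ α → H-ext λ { zero → BoolP.not-involutive x ; (suc i) → refl })
                   (∑ᶻ-not m (λ α → H (x ∷ᶠ α)) (∷-extensional H-ext x))

  ∑ᶻ-count-shift : ∀ m (F F′ : ℕ → ℤ) → (∀ t → suc t ≤ m → F (suc t) ≡ F′ (suc t)) →
                   ∑ᶻ m (F ∘ count) ≡ ∑ᶻ m (F′ ∘ count) + (F 0 - F′ 0)
  ∑ᶻ-count-shift zero    F F′ agree = lem (F 0) (F′ 0)
    where lem : ∀ a b → a ≡ b + (a - b)
          lem = solve-∀
  ∑ᶻ-count-shift (suc m) F F′ agree =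
    trans (cong₂ _+_ (∑ᶻ-cong m λ α → agree (count α) (s≤s (count-≤ α)))
                     (∑ᶻ-count-shift m F F′ λ t t<m → agree t (≤-trans t<m (n≤1+n m))))
          (sym (ℤ.+-assoc (∑ᶻ m (λ α → F′ (suc (count α)))) _ _))

  ∑ᶻ-binomial : ∀ m Y → ∑ᶻ m (λ α → Y ^ (m ∸ count α)) ≡ (Y + + 1) ^ m
  ∑ᶻ-binomial zero    Y = refl
  ∑ᶻ-binomial (suc m) Y = begin
    B + ∑ᶻ m (λ α → Y ^ (suc m ∸ count α))
      ≡⟨ cong (λ r → B + r) (∑ᶻ-cong m λ α → cong (Y ^_) (+-∸-assoc 1 (count-≤ α))) ⟩
    B + ∑ᶻ m (λ α → Y * Y ^ (m ∸ count α))
      ≡⟨ cong (λ r → B + r) (∑ᶻ-*ˡ m Y (λ α → Y ^ (m ∸ count α))) ⟩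
    B + Y * B
      ≡⟨ cong (λ P → P + Y * P) (∑ᶻ-binomial m Y) ⟩
    (Y + + 1) ^ m + Y * (Y + + 1) ^ m
      ≡⟨ lem Y ((Y + + 1) ^ m) ⟩
    (Y + + 1) ^ suc m ∎
    where
    open ≡-Reasoning
    B = ∑ᶻ m (λ α → Y ^ (m ∸ count α))
    lem : ∀ Y P → P + Y * P ≡ (Y + + 1) * P
    lem = solve-∀

  sumᴸ : ∀ {A : Set} → (A → ℤ) → List A → ℤ
  sumᴸ g = List.foldr (λ a r → g a + r) (+ 0)

  sumᴸ-++ : ∀ {A : Set} (g : A → ℤ) xs ys → sumᴸ g (xs List.++ ys) ≡ sumᴸ g xs + sumᴸ g ys
  sumᴸ-++ g []       ys = sym (ℤ.+-identityˡ _)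
  sumᴸ-++ g (x ∷ xs) ys = trans (cong (λ r → g x + r) (sumᴸ-++ g xs ys)) (sym (ℤ.+-assoc (g x) _ _))

  sumᴸ-map : ∀ {A B : Set} (g : B → ℤ) (f : A → B) xs → sumᴸ g (List.map f xs) ≡ sumᴸ (g ∘ f) xs
  sumᴸ-map g f []       = refl
  sumᴸ-map g f (x ∷ xs) = cong (λ r → g (f x) + r) (sumᴸ-map g f xs)

  sumᴸ-allSubsets : ∀ N (g : Subset N → ℤ) → sumᴸ g (allSubsets N) ≡ ∑ᶻ N (g ∘ tabulate)
  sumᴸ-allSubsets zero    g = ℤ.+-identityʳ (g [])
  sumᴸ-allSubsets (suc N) g = trans (sumᴸ-++ g (List.map (true ∷_) (allSubsets N)) (List.map (false ∷_) (allSubsets N)))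
    (cong₂ _+_ (trans (sumᴸ-map g (true ∷_) (allSubsets N)) (sumᴸ-allSubsets N (λ A → g (true ∷ A))))
               (trans (sumᴸ-map g (false ∷_) (allSubsets N)) (sumᴸ-allSubsets N (λ A → g (false ∷ A)))))

  ∑ᶻ-parities : ∀ k m (G : Vector Bool m → ℤ) → Extensional G →
                ∑ᶻ (m ℕ.* suc k) (λ f → G (parities (suc k) m f)) ≡ (+ 2) ^ (m ℕ.* k) * ∑ᶻ m G
  ∑ᶻ-parities k zero    G G-ext = trans (G-ext λ ()) (sym (ℤ.*-identityˡ _))
  ∑ᶻ-parities k (suc m) G G-ext = begin
    ∑ᶻ (suc k ℕ.+ m ℕ.* suc k) (λ f → G (parities (suc k) (suc m) f))
      ≡⟨ ∑ᶻ-++ (suc k) (m ℕ.* suc k) _ (λ f≗g → G-ext (parities-cong (suc k) (suc m) f≗g)) ⟩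
    ∑ᶻ (suc k) (λ b → ∑ᶻ (m ℕ.* suc k) (λ f → G (parities (suc k) (suc m) (b ++ f))))
      ≡⟨ ∑ᶻ-cong (suc k) (λ b → ∑ᶻ-cong (m ℕ.* suc k) λ f → G-ext (parities-++ b f)) ⟩
    ∑ᶻ (suc k) (λ b → ∑ᶻ (m ℕ.* suc k) (λ f → G (xorSum b ∷ᶠ parities (suc k) m f)))
      ≡⟨ ∑ᶻ-cong (suc k) (λ b → ∑ᶻ-parities k m (λ α → G (xorSum b ∷ᶠ α)) (∷-extensional G-ext (xorSum b))) ⟩
    ∑ᶻ (suc k) (λ b → (+ 2) ^ (m ℕ.* k) * S (xorSum b))
      ≡⟨ ∑ᶻ-*ˡ (suc k) ((+ 2) ^ (m ℕ.* k)) (S ∘ xorSum) ⟩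
    (+ 2) ^ (m ℕ.* k) * ∑ᶻ (suc k) (S ∘ xorSum)
      ≡⟨ cong ((+ 2) ^ (m ℕ.* k) *_) (∑ᶻ-xorSum k S) ⟩
    (+ 2) ^ (m ℕ.* k) * ((+ 2) ^ k * (S true + S false))
      ≡⟨ swap ((+ 2) ^ (m ℕ.* k)) ((+ 2) ^ k) (S true + S false) ⟩
    (+ 2) ^ k * (+ 2) ^ (m ℕ.* k) * (S true + S false)
      ≡⟨ cong (_* (S true + S false)) (ℤ.^-distribˡ-+-* (+ 2) k (m ℕ.* k)) ⟨
    (+ 2) ^ (suc m ℕ.* k) * ∑ᶻ (suc m) G ∎
    where
    open ≡-Reasoning
    S : Bool → ℤ
    S p = ∑ᶻ m (λ α → G (p ∷ᶠ α))
    swap : ∀ a b c → a * (b * c) ≡ b * a * c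
    swap = solve-∀
    parities-++ : ∀ b f → parities (suc k) (suc m) (b ++ f) ≗ xorSum b ∷ᶠ parities (suc k) m f
    parities-++ b f zero    = xorSum-cong (lookup-++ˡ b f)
    parities-++ b f (suc i) = parities-cong (suc k) m (lookup-++ʳ b f) i

  module _ (k m : ℕ) (z : ℤ) where

    windmillWidth-cong : ∀ a {α α′ : Vector Bool m} → α ≗ α′ → windmillWidth k m a α ≡ windmillWidth k m a α′
    windmillWidth-cong a α≗α′ =
      cong₂ (λ s t → (suc (m ℕ.* suc k) ∸ patternCost (not a) s) ∸ patternCost a t)
            (count-cong (λ i → cong (_xor parity (suc k)) (α≗α′ i))) (count-cong α≗α′)

    T-windmill : T-graph (windmill (suc (suc k)) m) z ≡
                 (+ 2) ^ (m ℕ.* k) * ∑ᶻ m (λ α → z ^ windmillWidth k m true α)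
                 + (+ 2) ^ (m ℕ.* k) * ∑ᶻ m (λ α → z ^ windmillWidth k m false α)
    T-windmill = begin
      T-graph (windmill (suc (suc k)) m) z
        ≡⟨ sumᴸ-allSubsets _ (λ A → z ^ width (D (windmill (suc (suc k)) m) ✱ A)) ⟩
      ∑ᶻ (suc (m ℕ.* suc k)) (λ f → z ^ width (D (windmill (suc (suc k)) m) ✱ tabulate f))
        ≡⟨ ∑ᶻ-cong _ (λ f → cong (z ^_) (trans (width-twisted k m (tabulate f))
             (windmillWidth-cong (f zero) (parities-cong (suc k) m (lookup∘tabulate (f ∘ suc)))))) ⟩
      ∑ᶻ (m ℕ.* suc k) (λ f → z ^ windmillWidth k m true (parities (suc k) m f))
        + ∑ᶻ (m ℕ.* suc k) (λ f → z ^ windmillWidth k m false (parities (suc k) m f))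
        ≡⟨ cong₂ _+_ (∑ᶻ-parities k m _ (cong (z ^_) ∘ windmillWidth-cong true))
                     (∑ᶻ-parities k m _ (cong (z ^_) ∘ windmillWidth-cong false)) ⟩
      (+ 2) ^ (m ℕ.* k) * ∑ᶻ m (λ α → z ^ windmillWidth k m true α)
        + (+ 2) ^ (m ℕ.* k) * ∑ᶻ m (λ α → z ^ windmillWidth k m false α) ∎
      where open ≡-Reasoning

    evenWidth : ℕ → ℕ
    evenWidth zero    = m ℕ.* k
    evenWidth (suc _) = m ℕ.* k ℕ.+ 2

    width-split-even : ∀ s t → s ℕ.+ t ≡ m → suc (m ℕ.* suc k) ≡ (s ℕ.+ oneHotDistance t) ℕ.+ evenWidth t
    width-split-even s zero    s+0≡m = trans (cong suc (*-suc m k))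
      (trans (cong (λ x → suc (x ℕ.+ m ℕ.* k)) (sym s+0≡m)) (lem s (m ℕ.* k)))
      where lem : ∀ s E → suc ((s ℕ.+ 0) ℕ.+ E) ≡ (s ℕ.+ 1) ℕ.+ E
            lem = ℕ-Solver.solve-∀
    width-split-even s (suc t) s+t≡m = trans (cong suc (*-suc m k))
      (trans (cong (λ x → suc (x ℕ.+ m ℕ.* k)) (sym s+t≡m)) (lem s t (m ℕ.* k)))
      where lem : ∀ s t E → suc ((s ℕ.+ suc t) ℕ.+ E) ≡ (s ℕ.+ t) ℕ.+ (E ℕ.+ 2)
            lem = ℕ-Solver.solve-∀

    width-even : ∀ s t → s ℕ.+ t ≡ m → suc (m ℕ.* suc k) ∸ (s ℕ.+ oneHotDistance t) ≡ evenWidth t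
    width-even s t s+t≡m = trans (cong (_∸ (s ℕ.+ oneHotDistance t)) (width-split-even s t s+t≡m))
                                 (m+n∸m≡n (s ℕ.+ oneHotDistance t) (evenWidth t))

    ∑ᶻ-evenWidth : ∑ᶻ m (λ α → z ^ evenWidth (count α))
                   ≡ (+ 2) ^ m * z ^ (m ℕ.* k ℕ.+ 2) + (z ^ (m ℕ.* k) - z ^ (m ℕ.* k ℕ.+ 2))
    ∑ᶻ-evenWidth = trans (∑ᶻ-count-shift m (λ t → z ^ evenWidth t) (λ _ → z ^ (m ℕ.* k ℕ.+ 2)) (λ _ _ → refl))
                         (cong (λ S → S + (z ^ (m ℕ.* k) - z ^ (m ℕ.* k ℕ.+ 2))) (∑ᶻ-const m (z ^ (m ℕ.* k ℕ.+ 2))))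

    module _ (K-odd : parity (suc k) ≡ true) where

      private
        countβ : Vector Bool m → ℕ
        countβ α = count (λ i → α i xor parity (suc k))

        count-complement : ∀ (α : Vector Bool m) → countβ α ℕ.+ count α ≡ m
        count-complement α = trans (cong (ℕ._+ count α) (count-cong λ i →
          trans (cong (α i xor_) K-odd) (BoolP.xor-comm (α i) true))) (count-not α)

      ∑ᶻ-width-odd-blades : ∀ a → ∑ᶻ m (λ α → z ^ windmillWidth k m a α) ≡ ∑ᶻ m (λ α → z ^ evenWidth (count α))
      ∑ᶻ-width-odd-blades true  = ∑ᶻ-cong m λ α → cong (z ^_)
        (trans (∸-+-assoc (suc (m ℕ.* suc k)) (countβ α) (oneHotDistance (count α)))
               (width-even (countβ α) (count α) (count-complement α)))
      ∑ᶻ-width-odd-blades false = begin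
        ∑ᶻ m (λ α → z ^ windmillWidth k m false α)
          ≡⟨ ∑ᶻ-cong m (λ α → cong (z ^_) (trans (∸-+-assoc (suc (m ℕ.* suc k)) (oneHotDistance (countβ α)) (count α))
               (trans (cong (suc (m ℕ.* suc k) ∸_) (+-comm (oneHotDistance (countβ α)) (count α)))
                      (width-even (count α) (countβ α) (trans (+-comm (count α) (countβ α)) (count-complement α)))))) ⟩
        ∑ᶻ m (λ α → z ^ evenWidth (count (λ i → α i xor parity (suc k))))
          ≡⟨ ∑ᶻ-cong m (λ α → cong (λ t → z ^ evenWidth t) (count-cong λ i →
               trans (cong (α i xor_) K-odd) (BoolP.xor-comm (α i) true))) ⟩
        ∑ᶻ m (λ α → z ^ evenWidth (count (not ∘ α)))
          ≡⟨ ∑ᶻ-not m (λ α → z ^ evenWidth (count α)) (cong (λ t → z ^ evenWidth t) ∘ count-cong) ⟩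
        ∑ᶻ m (λ α → z ^ evenWidth (count α)) ∎
        where open ≡-Reasoning

      T-windmill-even : T-graph (windmill (suc (suc k)) m) z ≡
                        (+ 2) ^ (m ℕ.* k ℕ.+ 1) * z ^ (m ℕ.* k) * (((+ 2) ^ m - + 1) * z ^ 2 + + 1)
      T-windmill-even = begin
        T-graph (windmill (suc (suc k)) m) z
          ≡⟨ T-windmill ⟩
        P * ∑ᶻ m (λ α → z ^ windmillWidth k m true α) + P * ∑ᶻ m (λ α → z ^ windmillWidth k m false α)
          ≡⟨ cong₂ (λ a b → P * a + P * b) (trans (∑ᶻ-width-odd-blades true) ∑ᶻ-evenWidth)
                                           (trans (∑ᶻ-width-odd-blades false) ∑ᶻ-evenWidth) ⟩
        P * (Q * z ^ (e ℕ.+ 2) + (z ^ e - z ^ (e ℕ.+ 2))) + P * (Q * z ^ (e ℕ.+ 2) + (z ^ e - z ^ (e ℕ.+ 2)))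
          ≡⟨ cong (λ w → P * (Q * w + (z ^ e - w)) + P * (Q * w + (z ^ e - w))) (ℤ.^-distribˡ-+-* z e 2) ⟩
        P * (Q * (z ^ e * z ^ 2) + (z ^ e - z ^ e * z ^ 2)) + P * (Q * (z ^ e * z ^ 2) + (z ^ e - z ^ e * z ^ 2))
          ≡⟨ factor P Q (z ^ e) (z ^ 2) ⟩
        P * (+ 2) * z ^ e * ((Q - + 1) * z ^ 2 + + 1)
          ≡⟨ cong (λ w → w * z ^ e * ((Q - + 1) * z ^ 2 + + 1)) (ℤ.^-distribˡ-+-* (+ 2) e 1) ⟨
        (+ 2) ^ (e ℕ.+ 1) * z ^ e * ((Q - + 1) * z ^ 2 + + 1) ∎
        where
        open ≡-Reasoning
        e = m ℕ.* k
        P = (+ 2) ^ e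
        Q = (+ 2) ^ m
        factor : ∀ P Q A B → P * (Q * (A * B) + (A - A * B)) + P * (Q * (A * B) + (A - A * B))
                           ≡ P * (+ 2) * A * ((Q - + 1) * B + + 1)
        factor = solve-∀

  module _ (k′ m : ℕ) (z : ℤ) where

    private
      mK = m ℕ.* suc (suc k′)
      e₀ = m ℕ.* k′ ℕ.+ 2

    oddWidth : ℕ → ℕ
    oddWidth t = suc mK ∸ (t ℕ.+ oneHotDistance t)

    oddWidth-suc : ∀ t → suc t ≤ m → z ^ oddWidth (suc t) ≡ z ^ e₀ * (z ^ 2) ^ (m ∸ suc t)
    oddWidth-suc t t<m = begin
      z ^ (suc mK ∸ (suc t ℕ.+ t))
        ≡⟨ cong (λ x → z ^ (x ∸ (suc t ℕ.+ t))) split ⟩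
      z ^ ((suc t ℕ.+ t) ℕ.+ (e₀ ℕ.+ 2 ℕ.* r) ∸ (suc t ℕ.+ t))
        ≡⟨ cong (z ^_) (m+n∸m≡n (suc t ℕ.+ t) (e₀ ℕ.+ 2 ℕ.* r)) ⟩
      z ^ (e₀ ℕ.+ 2 ℕ.* r)
        ≡⟨ ℤ.^-distribˡ-+-* z e₀ (2 ℕ.* r) ⟩
      z ^ e₀ * z ^ (2 ℕ.* r)
        ≡⟨ cong (z ^ e₀ *_) (ℤ.^-*-assoc z 2 r) ⟨
      z ^ e₀ * (z ^ 2) ^ r ∎
      where
      open ≡-Reasoning
      r = m ∸ suc t
      lem : ∀ t r k′ → suc ((suc t ℕ.+ r) ℕ.* suc (suc k′)) ≡ (suc t ℕ.+ t) ℕ.+ ((suc t ℕ.+ r) ℕ.* k′ ℕ.+ 2 ℕ.+ 2 ℕ.* r)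
      lem = ℕ-Solver.solve-∀
      split : suc mK ≡ (suc t ℕ.+ t) ℕ.+ (e₀ ℕ.+ 2 ℕ.* r)
      split = subst (λ m → suc (m ℕ.* suc (suc k′)) ≡ (suc t ℕ.+ t) ℕ.+ (m ℕ.* k′ ℕ.+ 2 ℕ.+ 2 ℕ.* r))
                    (m+[n∸m]≡n t<m) (lem t r k′)

    ∑ᶻ-oddWidth : ∑ᶻ m (λ α → z ^ oddWidth (count α)) ≡ z ^ e₀ * (z ^ 2 + + 1) ^ m + (z ^ mK - z ^ e₀ * (z ^ 2) ^ m)
    ∑ᶻ-oddWidth = begin
      ∑ᶻ m (λ α → z ^ oddWidth (count α))
        ≡⟨ ∑ᶻ-count-shift m (λ t → z ^ oddWidth t) (λ t → z ^ e₀ * (z ^ 2) ^ (m ∸ t)) oddWidth-suc ⟩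
      ∑ᶻ m (λ α → z ^ e₀ * (z ^ 2) ^ (m ∸ count α)) + (z ^ mK - z ^ e₀ * (z ^ 2) ^ m)
        ≡⟨ cong (_+ (z ^ mK - z ^ e₀ * (z ^ 2) ^ m))
                (trans (∑ᶻ-*ˡ m (z ^ e₀) (λ α → (z ^ 2) ^ (m ∸ count α))) (cong (z ^ e₀ *_) (∑ᶻ-binomial m (z ^ 2)))) ⟩
      z ^ e₀ * (z ^ 2 + + 1) ^ m + (z ^ mK - z ^ e₀ * (z ^ 2) ^ m) ∎
      where open ≡-Reasoning

    module _ (K-even : parity (suc (suc k′)) ≡ false) where

      ∑ᶻ-width-even-blades : ∀ a → ∑ᶻ m (λ α → z ^ windmillWidth (suc k′) m a α) ≡ ∑ᶻ m (λ α → z ^ oddWidth (count α))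
      ∑ᶻ-width-even-blades a = ∑ᶻ-cong m λ α → cong (z ^_)
        (trans (∸-+-assoc (suc mK) (patternCost (not a) (countβ α)) (patternCost a (count α)))
               (cong (suc mK ∸_) (costs a α)))
        where
        countβ : Vector Bool m → ℕ
        countβ α = count (λ i → α i xor parity (suc (suc k′)))
        countβ≡count : ∀ α → count (λ i → α i xor parity (suc (suc k′))) ≡ count α
        countβ≡count α = count-cong λ i → trans (cong (α i xor_) K-even) (BoolP.xor-identityʳ (α i))
        costs : ∀ a α → patternCost (not a) (count (λ i → α i xor parity (suc (suc k′))))
                        ℕ.+ patternCost a (count α) ≡ count α ℕ.+ oneHotDistance (count α)
        costs true  α = cong (ℕ._+ oneHotDistance (count α)) (countβ≡count α)
        costs false α = trans (cong (λ c → oneHotDistance c ℕ.+ count α) (countβ≡count α)) (+-comm _ (count α))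

  module _ (k′ m′ : ℕ) (z : ℤ) (K-even : parity (suc (suc k′)) ≡ false) where

    private
      m = suc m′

    T-windmill-odd : T-graph (windmill (suc (suc (suc k′))) m) z ≡
                     (+ 2) ^ (m ℕ.* suc k′ ℕ.+ 1) * z ^ (m ℕ.* k′ ℕ.+ 2)
                       * ((z ^ 2 + + 1) ^ m - z ^ (2 ℕ.* m) + z ^ (2 ℕ.* m ∸ 2))
    T-windmill-odd = begin
      T-graph (windmill (suc (suc (suc k′))) m) z
        ≡⟨ T-windmill (suc k′) m z ⟩
      P * ∑ᶻ m (λ α → z ^ windmillWidth (suc k′) m true α) + P * ∑ᶻ m (λ α → z ^ windmillWidth (suc k′) m false α)
        ≡⟨ cong₂ (λ a b → P * a + P * b) (trans (∑ᶻ-width-even-blades k′ m z K-even true) (∑ᶻ-oddWidth k′ m z))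
                                         (trans (∑ᶻ-width-even-blades k′ m z K-even false) (∑ᶻ-oddWidth k′ m z)) ⟩
      P * (A * W + (z ^ (m ℕ.* suc (suc k′)) - A * U)) + P * (A * W + (z ^ (m ℕ.* suc (suc k′)) - A * U))
        ≡⟨ cong (λ w → P * (A * W + (w - A * U)) + P * (A * W + (w - A * U)))
                (trans (cong (z ^_) mK≡e₀+2m-2) (ℤ.^-distribˡ-+-* z (m ℕ.* k′ ℕ.+ 2) _)) ⟩
      P * (A * W + (A * V - A * U)) + P * (A * W + (A * V - A * U))
        ≡⟨ factor P A W U V ⟩
      P * (+ 2) * A * (W - U + V)
        ≡⟨ cong₂ (λ p u → p * A * (W - u + V)) (ℤ.^-distribˡ-+-* (+ 2) (m ℕ.* suc k′) 1) (sym (ℤ.^-*-assoc z 2 m)) ⟨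
      (+ 2) ^ (m ℕ.* suc k′ ℕ.+ 1) * A * (W - z ^ (2 ℕ.* m) + V) ∎
      where
      open ≡-Reasoning
      P = (+ 2) ^ (m ℕ.* suc k′)
      A = z ^ (m ℕ.* k′ ℕ.+ 2)
      W = (z ^ 2 + + 1) ^ m
      U = (z ^ 2) ^ m
      V = z ^ (2 ℕ.* m ∸ 2)
      lem : ∀ m′ k′ → suc m′ ℕ.* suc (suc k′) ≡ (suc m′ ℕ.* k′ ℕ.+ 2) ℕ.+ 2 ℕ.* m′
      lem = ℕ-Solver.solve-∀
      mK≡e₀+2m-2 : m ℕ.* suc (suc k′) ≡ (m ℕ.* k′ ℕ.+ 2) ℕ.+ (2 ℕ.* m ∸ 2)
      mK≡e₀+2m-2 = trans (lem m′ k′) (cong ((m ℕ.* k′ ℕ.+ 2) ℕ.+_)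
                     (sym (trans (cong (_∸ 2) (*-suc 2 m′)) (m+n∸m≡n 2 (2 ℕ.* m′)))))
      factor : ∀ P A W U V → P * (A * W + (A * V - A * U)) + P * (A * W + (A * V - A * U)) ≡ P * (+ 2) * A * (W - U + V)
      factor = solve-∀
open Sizes using (parity)
open Summation using (T-windmill-even; T-windmill-odd)

open import Defs
open import Data.Nat using (ℕ; _≤_; _∸_; _%_)
open import Data.Integer using (ℤ; _+_; _-_; _*_; _^_)
open import Data.Product using (_×_)
open import Relation.Binary.PropositionalEquality using (_≡_)

parity-even : ∀ n → n % 2 ≡ 0 → parity n ≡ false
parity-even zero          _      = refl
parity-even (suc (suc n)) n-even = cong (not ∘ not) (parity-even n n-even)

parity-odd : ∀ n → n % 2 ≡ 1 → parity n ≡ true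
parity-odd (suc zero)    _     = refl
parity-odd (suc (suc n)) n-odd = cong (not ∘ not) (parity-odd n n-odd)

proposition4p7 : (n m : ℕ) → 2 ≤ n → 1 ≤ m →
    ((n % 2 ≡ 0) → ∀ (z : ℤ) →
      T-graph (windmill n m) z
        ≡ (Data.Integer.+ 2) ^ (m Data.Nat.* (n ∸ 2) Data.Nat.+ 1) * z ^ (m Data.Nat.* (n ∸ 2))
          * (((Data.Integer.+ 2) ^ m - Data.Integer.+ 1) * z ^ 2 + Data.Integer.+ 1))
    ×
    ((n % 2 ≡ 1) → ∀ (z : ℤ) →
      T-graph (windmill n m) z
        ≡ (Data.Integer.+ 2) ^ (m Data.Nat.* (n ∸ 2) Data.Nat.+ 1) * z ^ (m Data.Nat.* (n ∸ 3) Data.Nat.+ 2)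
          * ((z ^ 2 + Data.Integer.+ 1) ^ m - z ^ (2 Data.Nat.* m) + z ^ (2 Data.Nat.* m ∸ 2)))
proposition4p7 (suc (suc zero)) (suc m′) (s≤s (s≤s z≤n)) (s≤s z≤n) =
  (λ _ z → T-windmill-even 0 (suc m′) z refl) , λ ()
proposition4p7 (suc (suc (suc k′))) (suc m′) (s≤s (s≤s z≤n)) (s≤s z≤n) =
  (λ n-even z → T-windmill-even (suc k′) (suc m′) z (BoolP.not-injective (parity-even (3 ℕ.+ k′) n-even))) ,
  (λ n-odd z → T-windmill-odd k′ m′ z (BoolP.not-injective (parity-odd (3 ℕ.+ k′) n-odd)))
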